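{- For integers $n,\ell\ge 0$ let $K_{n,\ell}$ denote the number of flip-equivalence classes of binary trees with $n$ nodes in which exactly $\ell$ nodes have non-equivalent child subtrees (as defined in the context). Let $L(x,y)=\sum_{n\ge 0}\sum_{\ell\ge 0}K_{n,\ell}\,x^n y^\ell$, a formal power series in $x,y$. Then $$L(x,y)=1+\frac{x\,y\,L(x,y)^2}{2}+x\left(1-\frac{y}{2}\right)L(x^2,y^2).$$
   Context: A binary tree is either the empty tree or consists of a root node together with an ordered pair (left subtree, right subtree) of binary trees (either of which may be empty); its number of nodes is counted recursively (the empty tree has $0$ nodes). Two binary trees are flip-equivalent if both are empty, or both are nonempty and either (left of first $\sim$ left of second and right of first $\sim$ right of second) or (left of first $\sim$ right of second and right of first $\sim$ left of second); equivalently, one can be obtained from the other by swapping the two children of any set of nodes. This is an equivalence relation (isomorphism of binary trees with labeled root). For a node $v$ of a tree, its two child subtrees (possibly empty) are the subtrees rooted at its left and right children; $v$ is said to have non-equivalent child subtrees if these two subtrees are not flip-equivalent (e.g. a node with exactly one nonempty child always qualifies; a leaf never does). The number of such nodes is invariant under flip-equivalence, so it is well defined for an equivalence class; the class then contains exactly $2^\ell$ ordered binary trees, where $\ell$ is this number. -}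

module Defs where

open import Data.Bool using (Bool; true; false; _∧_; _∨_; not; if_then_else_)
open import Data.Nat as ℕ using (ℕ; zero; suc; _∸_; ⌊_/2⌋; _≡ᵇ_)
open import Data.Nat.Properties using ()
open import Data.List using (List; []; _∷_; _++_; map; concatMap; length; filterᵇ; deduplicateᵇ; upTo; foldr)
open import Data.Integer using (+_)
open import Data.Rational as ℚ using (ℚ; 0ℚ; 1ℚ; ½; _/_)

data Tree : Set where
  empty : Tree
  node  : Tree → Tree → Tree

size : Tree → ℕ
size empty      = 0
size (node l r) = suc (size l ℕ.+ size r)

flipEq : Tree → Tree → Bool
flipEq empty        empty          = true
flipEq empty        (node _ _)     = false
flipEq (node _ _)   empty          = false
flipEq (node l₁ r₁) (node l₂ r₂)   =
  (flipEq l₁ l₂ ∧ flipEq r₁ r₂) ∨ (flipEq l₁ r₂ ∧ flipEq r₁ l₂)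

nonEqNodes : Tree → ℕ
nonEqNodes empty      = 0
nonEqNodes (node l r) =
  (if flipEq l r then 0 else 1) ℕ.+ nonEqNodes l ℕ.+ nonEqNodes r

-- complete list of all (ordered) binary trees with exactly n nodes
-- (fuel-based so the recursion is structural)
treesUpTo : ℕ → ℕ → List Tree
treesUpTo zero    n       = empty ∷ []     -- unused in practice (fuel ≥ n)
treesUpTo (suc f) zero    = empty ∷ []
treesUpTo (suc f) (suc n) =
  concatMap (λ i → concatMap (λ l → map (node l) (treesUpTo f (n ∸ i)))
                              (treesUpTo f i))
            (upTo (suc n))

allTrees : ℕ → List Tree
allTrees n = treesUpTo (suc n) n

-- Computed as the number of class representatives left after removing,
-- from the list of all such trees, every tree equivalent to an earlier one.
K : ℕ → ℕ → ℕ
K n ℓ = length (deduplicateᵇ flipEq (filterᵇ (λ t → nonEqNodes t ≡ᵇ ℓ) (allTrees n)))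

-- Formal power series in two variables x, y over ℚ, given by coefficients:
-- f n ℓ is the coefficient of x^n y^ℓ.

PS : Set
PS = ℕ → ℕ → ℚ

fromℕℚ : ℕ → ℚ
fromℕℚ k = + k / 1

const : ℚ → PS
const c zero zero = c
const c _    _    = 0ℚ

X : PS
X (suc zero) zero = 1ℚ
X _          _    = 0ℚ

Y : PS
Y zero (suc zero) = 1ℚ
Y _    _          = 0ℚ

infixl 6 _⊕_ _⊖_
infixl 7 _⊗_ _·_

_⊕_ : PS → PS → PS
(f ⊕ g) n ℓ = f n ℓ ℚ.+ g n ℓ

_⊖_ : PS → PS → PS
(f ⊖ g) n ℓ = f n ℓ ℚ.- g n ℓ

_·_ : ℚ → PS → PS
(c · f) n ℓ = c ℚ.* f n ℓ

sumℚ : List ℚ → ℚ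
sumℚ = foldr ℚ._+_ 0ℚ

_⊗_ : PS → PS → PS
(f ⊗ g) n ℓ =
  sumℚ (map (λ i → sumℚ (map (λ j → f i j ℚ.* g (n ∸ i) (ℓ ∸ j)) (upTo (suc ℓ))))
            (upTo (suc n)))

isEven : ℕ → Bool
isEven zero          = true
isEven (suc zero)    = false
isEven (suc (suc n)) = isEven n

squareVars : PS → PS
squareVars f n ℓ = if isEven n ∧ isEven ℓ then f ⌊ n /2⌋ ⌊ ℓ /2⌋ else 0ℚ

L : PS
L n ℓ = fromℕℚ (K n ℓ)

-- Each flip-equivalence class contains exactly 2^ℓ ordered trees, ℓ being its number of
-- nodes with non-equivalent child subtrees: by induction, the ordered trees equivalent to
-- node a b are the node l r with l ∼ a, r ∼ b, together with those with l ∼ b, r ∼ a,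
-- and these two families coincide when a ∼ b and are disjoint otherwise. Hence the number
-- of ordered trees with n nodes and ℓ such nodes is K n ℓ · 2^ℓ. Splitting ordered trees
-- at the root, those with m + 1 nodes are the pairs (l, r) with m nodes in total, and the
-- root contributes to ℓ exactly when l ≁ r. All pairs are counted by the convolution
-- K ⊛ K (times 2^ℓ), and the pairs with l ∼ r by K(m/2, ℓ/2) · 2^ℓ when m and ℓ are even.
-- Comparing the two counts gives K(m+1, 0) = [m even] K(m/2, 0) and
-- 2 K(m+1, k+1) + S(m, k) = (K ⊛ K)(m, k) + 2 S(m, k+1), where S are the coefficients of
-- L(x², y²); this is the functional equation read off coefficientwise.

module Submission where

open import Defs
open import Algebra.Bundles using (CommutativeSemiring; CommutativeRing)
open import Data.Bool using (Bool; true; false; T; not; _∧_; _∨_; if_then_else_)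
open import Data.Bool.Properties using (T-∧; T-∨; T-≡)
open import Data.Empty using (⊥; ⊥-elim)
open import Data.List using (List; []; _∷_; _++_; map; concat; concatMap; foldr; upTo; length; filter; filterᵇ; deduplicate)
open import Data.List.Properties using (map-∘; map-upTo; map-applyUpTo; map-cong-local)
open import Data.List.Relation.Unary.All as All using (All; []; _∷_)
open import Data.List.Relation.Unary.All.Properties using (all-upTo; all-filter; filter⁺; deduplicate⁺; concat⁺; map⁺)
open import Data.Nat using (ℕ; zero; suc; _∸_; _<_; _≤_; z≤n; s≤s; _≡ᵇ_; _≟_; ⌊_/2⌋)
import Data.Nat.Properties as ℕP
open import Data.Nat.Tactic.RingSolver using (solve-∀)
open import Data.Product using (_×_; _,_)
open import Data.Rational as ℚ using (ℚ; 0ℚ; 1ℚ; ½)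
import Data.Rational.Properties as ℚP
open import Data.Rational.Solver using (module +-*-Solver)
open import Data.Rational using (toℚᵘ)
import Data.Rational.Unnormalised as ℚᵘ
import Data.Rational.Unnormalised.Properties as ℚᵘP
import Data.Integer as ℤ
import Data.Integer.Properties as ℤP
open import Data.Sum using (inj₁; inj₂)
open import Function using (_∘_; Equivalence)
open import Relation.Binary.Structures using (IsEquivalence)
import Relation.Binary.PropositionalEquality as ≡
open ≡ using (_≡_; _≢_)
open import Relation.Nullary using (does; ¬_; yes; no; ¬?; T?)
open import Relation.Nullary.Decidable using (dec-true)
open import Relation.Binary.Core using (Rel)
open import Relation.Binary.Definitions using () renaming (Decidable to Decidable₂)
open import Level using (0ℓ)
open import Relation.Unary using (Decidable)

module FiniteSum {c ℓ} (R : CommutativeSemiring c ℓ) where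

  open CommutativeSemiring R
  open import Algebra.Properties.CommutativeSemigroup +-commutativeSemigroup using (interchange)
  open import Relation.Binary.Reasoning.Setoid setoid

  private variable
    A B : Set
    f g : A → Carrier

  ∑ : (A → Carrier) → List A → Carrier
  ∑ f xs = foldr _+_ 0# (map f xs)

  ∑-congᴬ : {xs : List A} → All (λ x → f x ≈ g x) xs → ∑ f xs ≈ ∑ g xs
  ∑-congᴬ []       = refl
  ∑-congᴬ (e ∷ es) = +-cong e (∑-congᴬ es)

  ∑-cong : (∀ x → f x ≈ g x) → ∀ xs → ∑ f xs ≈ ∑ g xs
  ∑-cong e xs = ∑-congᴬ (All.universal e xs)

  ∑-zeroᴬ : {xs : List A} → All (λ x → f x ≈ 0#) xs → ∑ f xs ≈ 0#
  ∑-zeroᴬ []       = refl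
  ∑-zeroᴬ (e ∷ es) = trans (+-cong e (∑-zeroᴬ es)) (+-identityˡ 0#)

  ∑-zero : (∀ x → f x ≈ 0#) → ∀ xs → ∑ f xs ≈ 0#
  ∑-zero e xs = ∑-zeroᴬ (All.universal e xs)

  ∑-++ : ∀ xs ys → ∑ f (xs ++ ys) ≈ ∑ f xs + ∑ f ys
  ∑-++ []       ys = sym (+-identityˡ _)
  ∑-++ (x ∷ xs) ys = trans (+-congˡ (∑-++ xs ys)) (sym (+-assoc _ _ _))

  ∑-concatMap : (h : A → List B) → ∀ xs → ∑ f (concatMap h xs) ≈ ∑ (λ x → ∑ f (h x)) xs
  ∑-concatMap h []       = refl
  ∑-concatMap h (x ∷ xs) = trans (∑-++ (h x) (concatMap h xs)) (+-congˡ (∑-concatMap h xs))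

  ∑-map : (h : A → B) → ∀ xs → ∑ f (map h xs) ≡ ∑ (f ∘ h) xs
  ∑-map h xs = ≡.cong (foldr _+_ 0#) (≡.sym (map-∘ xs))

  ∑-+ : ∀ xs → ∑ (λ x → f x + g x) xs ≈ ∑ f xs + ∑ g xs
  ∑-+ []       = sym (+-identityˡ 0#)
  ∑-+ (x ∷ xs) = trans (+-congˡ (∑-+ xs)) (interchange _ _ _ _)

  ∑-*ˡ : ∀ a xs → ∑ (λ x → a * f x) xs ≈ a * ∑ f xs
  ∑-*ˡ a []       = sym (zeroʳ a)
  ∑-*ˡ a (x ∷ xs) = trans (+-congˡ (∑-*ˡ a xs)) (sym (distribˡ a _ _))

  ∑-*ʳ : ∀ a xs → ∑ (λ x → f x * a) xs ≈ ∑ f xs * a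
  ∑-*ʳ a []       = sym (zeroˡ a)
  ∑-*ʳ a (x ∷ xs) = trans (+-congˡ (∑-*ʳ a xs)) (sym (distribʳ a _ _))

  ∑-swap : (h : A → B → Carrier) → ∀ xs ys →
           ∑ (λ x → ∑ (h x) ys) xs ≈ ∑ (λ y → ∑ (λ x → h x y) xs) ys
  ∑-swap h []       ys = sym (∑-zero (λ _ → refl) ys)
  ∑-swap h (x ∷ xs) ys = trans (+-congˡ (∑-swap h xs ys)) (sym (∑-+ ys))

  ∑-product : ∀ xs ys → ∑ (λ x → ∑ (λ y → f x * g y) ys) xs ≈ ∑ f xs * ∑ g ys
  ∑-product {f = f} {g = g} xs ys = trans (∑-cong (λ x → ∑-*ˡ (f x) ys) xs) (∑-*ʳ (∑ g ys) xs)

  ∑-upTo-suc : ∀ (h : ℕ → Carrier) n → ∑ h (upTo (suc n)) ≡ h 0 + ∑ (h ∘ suc) (upTo n)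
  ∑-upTo-suc h n = ≡.cong (λ ys → h 0 + foldr _+_ 0# ys)
    (≡.trans (map-applyUpTo suc h n) (≡.sym (map-upTo (h ∘ suc) n)))

  ∑-upTo-head : ∀ (h : ℕ → Carrier) n → (∀ i → h (suc i) ≈ 0#) → ∑ h (upTo (suc n)) ≈ h 0
  ∑-upTo-head h n tail≈0 = begin
    ∑ h (upTo (suc n))         ≡⟨ ∑-upTo-suc h n ⟩
    h 0 + ∑ (h ∘ suc) (upTo n) ≈⟨ +-congˡ (∑-zero tail≈0 (upTo n)) ⟩
    h 0 + 0#                   ≈⟨ +-identityʳ (h 0) ⟩
    h 0                        ∎

  ∑-upTo-cong : ∀ {h k : ℕ → Carrier} n → (∀ {i} → i < n → h i ≈ k i) → ∑ h (upTo n) ≈ ∑ k (upTo n)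
  ∑-upTo-cong n e = ∑-congᴬ (All.map e (all-upTo n))

  ∑-upTo-collapse : ∀ (h : ℕ → Carrier) {n p} → p < n → (∀ {i} → i < n → i ≢ p → h i ≈ 0#) →
                    ∑ h (upTo n) ≈ h p
  ∑-upTo-collapse h {suc n} {zero} _ e = begin
    ∑ h (upTo (suc n))             ≡⟨ ∑-upTo-suc h n ⟩
    h 0 + ∑ (h ∘ suc) (upTo n)     ≈⟨ +-congˡ (∑-zeroᴬ (All.map (λ i<n → e (s≤s i<n) λ ()) (all-upTo n))) ⟩
    h 0 + 0#                       ≈⟨ +-identityʳ (h 0) ⟩
    h 0                            ∎
  ∑-upTo-collapse h {suc n} {suc p} (s≤s p<n) e = begin
    ∑ h (upTo (suc n))             ≡⟨ ∑-upTo-suc h n ⟩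
    h 0 + ∑ (h ∘ suc) (upTo n)     ≈⟨ +-cong (e (s≤s z≤n) λ ())
                                             (∑-upTo-collapse (h ∘ suc) p<n λ i<n i≢p →
                                               e (s≤s i<n) (i≢p ∘ ℕP.suc-injective)) ⟩
    0# + h (suc p)                 ≈⟨ +-identityˡ (h (suc p)) ⟩
    h (suc p)                      ∎

open FiniteSum ℕP.+-*-commutativeSemiring
module ℚ∑ = FiniteSum (CommutativeRing.commutativeSemiring ℚP.+-*-commutativeRing)

open ≡ using (refl; sym; trans; cong; cong₂; subst; module ≡-Reasoning)
open import Data.Nat using (_+_; _*_; _^_)

open import Algebra.Properties.CommutativeSemigroup ℕP.+-commutativeSemigroup using (xy∙z≈xz∙y)
open import Algebra.Properties.CommutativeSemigroup ℕP.*-commutativeSemigroup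
  using (x∙yz≈y∙xz) renaming (interchange to *-interchange)

𝟙 : Bool → ℕ
𝟙 b = if b then 1 else 0

count : {A : Set} → (A → Bool) → List A → ℕ
count p = ∑ (𝟙 ∘ p)

T-injective : ∀ {x y} → (T x → T y) → (T y → T x) → x ≡ y
T-injective {false} {false} _ _ = refl
T-injective {false} {true}  _ g = ⊥-elim (g _)
T-injective {true}  {false} f _ = ⊥-elim (f _)
T-injective {true}  {true}  _ _ = refl

𝟙-T : ∀ {b} → T b → 𝟙 b ≡ 1
𝟙-T {true} _ = refl

𝟙-¬T : ∀ {b} → ¬ T b → 𝟙 b ≡ 0
𝟙-¬T {false} _ = refl
𝟙-¬T {true}  h = ⊥-elim (h _)

𝟙-≡ᵇ : ∀ {m n} → m ≡ n → 𝟙 (m ≡ᵇ n) ≡ 1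
𝟙-≡ᵇ {m} {n} m≡n = 𝟙-T (ℕP.≡⇒≡ᵇ m n m≡n)

𝟙-≢ᵇ : ∀ {m n} → m ≢ n → 𝟙 (m ≡ᵇ n) ≡ 0
𝟙-≢ᵇ {m} {n} m≢n = 𝟙-¬T (m≢n ∘ ℕP.≡ᵇ⇒≡ m n)

𝟙-∧ : ∀ x y → 𝟙 (x ∧ y) ≡ 𝟙 x * 𝟙 y
𝟙-∧ true  y = sym (ℕP.+-identityʳ (𝟙 y))
𝟙-∧ false y = refl

𝟙-*-absorbˡ : ∀ x y → (T y → T x) → 𝟙 x * 𝟙 y ≡ 𝟙 y
𝟙-*-absorbˡ true  y     _ = ℕP.+-identityʳ (𝟙 y)
𝟙-*-absorbˡ false false _ = refl
𝟙-*-absorbˡ false true  h = ⊥-elim (h _)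

𝟙-*-cong : ∀ x {m n} → (T x → m ≡ n) → 𝟙 x * m ≡ 𝟙 x * n
𝟙-*-cong true  m≡n = cong (_+ 0) (m≡n _)
𝟙-*-cong false _   = refl

𝟙-not : ∀ x → 𝟙 x + 𝟙 (not x) ≡ 1
𝟙-not true  = refl
𝟙-not false = refl

𝟙-∨-absorb : ∀ x y → (T y → T x) → 𝟙 (x ∨ y) ≡ 𝟙 x
𝟙-∨-absorb true  _     _ = refl
𝟙-∨-absorb false false _ = refl
𝟙-∨-absorb false true  h = ⊥-elim (h _)

𝟙-∨-disjoint : ∀ x y → (T x → T y → ⊥) → 𝟙 (x ∨ y) ≡ 𝟙 x + 𝟙 y
𝟙-∨-disjoint true  true  h = ⊥-elim (h _ _)
𝟙-∨-disjoint true  false _ = refl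
𝟙-∨-disjoint false _     _ = refl

∑-filter : ∀ {A : Set} {P : A → Set} (P? : Decidable P) (f : A → ℕ) xs →
           ∑ f (filter P? xs) ≡ ∑ (λ x → 𝟙 (does (P? x)) * f x) xs
∑-filter P? f []       = refl
∑-filter P? f (x ∷ xs) with does (P? x)
... | true  = cong₂ _+_ (sym (ℕP.+-identityʳ (f x))) (∑-filter P? f xs)
... | false = ∑-filter P? f xs

∑-const : ∀ {A : Set} c (xs : List A) → ∑ (λ _ → c) xs ≡ length xs * c
∑-const c []       = refl
∑-const c (x ∷ xs) = cong (c +_) (∑-const c xs)

length-filterᵇ : ∀ {A : Set} (p : A → Bool) xs → length (filterᵇ p xs) ≡ count p xs
length-filterᵇ p []       = refl
length-filterᵇ p (x ∷ xs) with p x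
... | true  = cong suc (length-filterᵇ p xs)
... | false = length-filterᵇ p xs

-- `deduplicate` keeps the first member of each class, so a list is partitioned into the
-- classes of its representatives.
module Deduplicate {A : Set} {_≈_ : Rel A 0ℓ} (≈-isEquivalence : IsEquivalence _≈_) (_≈?_ : Decidable₂ _≈_) where

  open IsEquivalence ≈-isEquivalence renaming (refl to ≈-refl; sym to ≈-sym; trans to ≈-trans)

  classSizeIn : A → List A → ℕ
  classSizeIn x = count (λ y → does (x ≈? y))

  representatives : List A → List A
  representatives = deduplicate _≈?_

  private
    does-resp : ∀ {x y} → x ≈ y → ∀ z → does (x ≈? z) ≡ does (y ≈? z)
    does-resp {x} {y} x≈y z with x ≈? z | y ≈? z
    ... | yes _   | yes _   = refl
    ... | no  _   | no  _   = refl
    ... | yes x≈z | no  y≉z = ⊥-elim (y≉z (≈-trans (≈-sym x≈y) x≈z))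
    ... | no  x≉z | yes y≈z = ⊥-elim (x≉z (≈-trans x≈y y≈z))

    classSizeIn-self : ∀ x xs → classSizeIn x (x ∷ xs) ≡ suc (classSizeIn x xs)
    classSizeIn-self x xs = cong (λ b → 𝟙 b + classSizeIn x xs) (dec-true (x ≈? x) ≈-refl)

  ∑-classSizeIn-representatives : ∀ z xs →
    ∑ (λ x → 𝟙 (does (z ≈? x)) * classSizeIn x xs) (representatives xs) ≡ classSizeIn z xs
  ∑-classSizeIn-representatives z [] = refl
  ∑-classSizeIn-representatives z (x ∷ xs) with z ≈? x
  ... | yes z≈x = begin
      classSizeIn x (x ∷ xs) + 0 + ∑ weight (filter (¬? ∘ (x ≈?_)) (representatives xs))
        ≡⟨ cong₂ _+_ (ℕP.+-identityʳ _) (trans (∑-filter (¬? ∘ (x ≈?_)) weight (representatives xs))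
                                               (∑-zero noOtherRepresentative (representatives xs))) ⟩
      classSizeIn x (x ∷ xs) + 0
        ≡⟨ ℕP.+-identityʳ _ ⟩
      classSizeIn x (x ∷ xs)
        ≡⟨ classSizeIn-self x xs ⟩
      suc (classSizeIn x xs)
        ≡⟨ cong suc (∑-cong (λ y → cong 𝟙 (does-resp (≈-sym z≈x) y)) xs) ⟩
      suc (classSizeIn z xs) ∎
    where
    open ≡-Reasoning
    weight : A → ℕ
    weight y = 𝟙 (does (z ≈? y)) * classSizeIn y (x ∷ xs)
    noOtherRepresentative : ∀ y → 𝟙 (not (does (x ≈? y))) * weight y ≡ 0
    noOtherRepresentative y with x ≈? y | z ≈? y
    ... | yes _   | _       = refl
    ... | no  _   | no  _   = refl
    ... | no  x≉y | yes z≈y = ⊥-elim (x≉y (≈-trans (≈-sym z≈x) z≈y))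
  ... | no z≉x = begin
      ∑ weight (filter (¬? ∘ (x ≈?_)) (representatives xs))
        ≡⟨ ∑-filter (¬? ∘ (x ≈?_)) weight (representatives xs) ⟩
      ∑ (λ y → 𝟙 (not (does (x ≈? y))) * weight y) (representatives xs)
        ≡⟨ ∑-cong drop-x (representatives xs) ⟩
      ∑ (λ y → 𝟙 (does (z ≈? y)) * classSizeIn y xs) (representatives xs)
        ≡⟨ ∑-classSizeIn-representatives z xs ⟩
      classSizeIn z xs ∎
    where
    open ≡-Reasoning
    weight : A → ℕ
    weight y = 𝟙 (does (z ≈? y)) * classSizeIn y (x ∷ xs)
    drop-x : ∀ y → 𝟙 (not (does (x ≈? y))) * weight y ≡ 𝟙 (does (z ≈? y)) * classSizeIn y xs
    drop-x y with z ≈? y | x ≈? y | y ≈? x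
    ... | no  _   | x≈?y    | _       = ℕP.*-zeroʳ (𝟙 (not (does x≈?y)))
    ... | yes z≈y | yes x≈y | _       = ⊥-elim (z≉x (≈-trans z≈y (≈-sym x≈y)))
    ... | yes z≈y | no  _   | yes y≈x = ⊥-elim (z≉x (≈-trans z≈y y≈x))
    ... | yes _   | no  _   | no  _   = ℕP.+-identityʳ (classSizeIn y xs + 0)

  length≡∑-classSizeIn : ∀ xs → length xs ≡ ∑ (λ x → classSizeIn x xs) (representatives xs)
  length≡∑-classSizeIn []       = refl
  length≡∑-classSizeIn (x ∷ xs) = sym (begin
      classSizeIn x (x ∷ xs) + ∑ (λ y → classSizeIn y (x ∷ xs)) (filter (¬? ∘ (x ≈?_)) (representatives xs))
        ≡⟨ cong₂ _+_ (classSizeIn-self x xs) (∑-filter (¬? ∘ (x ≈?_)) _ (representatives xs)) ⟩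
      suc (classSizeIn x xs) + ∑ (λ y → 𝟙 (not (does (x ≈? y))) * classSizeIn y (x ∷ xs)) (representatives xs)
        ≡⟨ cong₂ (λ m n → suc (m + n)) (sym (∑-classSizeIn-representatives x xs))
                                        (∑-cong outsideClassOfX (representatives xs)) ⟩
      suc (∑ (λ y → 𝟙 (does (x ≈? y)) * classSizeIn y xs) (representatives xs)
           + ∑ (λ y → 𝟙 (not (does (x ≈? y))) * classSizeIn y xs) (representatives xs))
        ≡⟨ cong suc (sym (∑-+ (representatives xs))) ⟩
      suc (∑ (λ y → 𝟙 (does (x ≈? y)) * classSizeIn y xs + 𝟙 (not (does (x ≈? y))) * classSizeIn y xs) (representatives xs))
        ≡⟨ cong suc (∑-cong (λ y → trans (sym (ℕP.*-distribʳ-+ _ (𝟙 (does (x ≈? y))) _))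
                                          (trans (cong (_* classSizeIn y xs) (𝟙-not (does (x ≈? y))))
                                                 (ℕP.*-identityˡ _)))
                            (representatives xs)) ⟩
      suc (∑ (λ y → classSizeIn y xs) (representatives xs))
        ≡⟨ cong suc (sym (length≡∑-classSizeIn xs)) ⟩
      suc (length xs) ∎)
    where
    open ≡-Reasoning
    outsideClassOfX : ∀ y → 𝟙 (not (does (x ≈? y))) * classSizeIn y (x ∷ xs) ≡ 𝟙 (not (does (x ≈? y))) * classSizeIn y xs
    outsideClassOfX y with x ≈? y | y ≈? x
    ... | yes _   | _       = refl
    ... | no  _   | no  _   = refl
    ... | no  x≉y | yes y≈x = ⊥-elim (x≉y (≈-sym y≈x))

-- Flip-equivalence

private variable
  a b c d s t u : Tree

infix 4 _∼_
data _∼_ : Tree → Tree → Set where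
  ∼-empty    : empty ∼ empty
  ∼-straight : a ∼ c → b ∼ d → node a b ∼ node c d
  ∼-crossed  : a ∼ d → b ∼ c → node a b ∼ node c d

flipEq-sound : ∀ s t → T (flipEq s t) → s ∼ t
flipEq-sound empty      empty      _ = ∼-empty
flipEq-sound (node a b) (node c d) h with Equivalence.to (T-∨ {flipEq a c ∧ flipEq b d}) h
... | inj₁ h′ = let (a∼c , b∼d) = Equivalence.to (T-∧ {flipEq a c}) h′ in
                ∼-straight (flipEq-sound a c a∼c) (flipEq-sound b d b∼d)
... | inj₂ h′ = let (a∼d , b∼c) = Equivalence.to (T-∧ {flipEq a d}) h′ in
                ∼-crossed (flipEq-sound a d a∼d) (flipEq-sound b c b∼c)

flipEq-complete : s ∼ t → T (flipEq s t)
flipEq-complete ∼-empty = _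
flipEq-complete (∼-straight {a = a} {c = c} {b = b} {d = d} a∼c b∼d) =
  Equivalence.from (T-∨ {flipEq a c ∧ flipEq b d})
    (inj₁ (Equivalence.from T-∧ (flipEq-complete a∼c , flipEq-complete b∼d)))
flipEq-complete (∼-crossed {a = a} {d = d} {b = b} {c = c} a∼d b∼c) =
  Equivalence.from (T-∨ {flipEq a c ∧ flipEq b d})
    (inj₂ (Equivalence.from T-∧ (flipEq-complete a∼d , flipEq-complete b∼c)))

∼-refl : ∀ t → t ∼ t
∼-refl empty      = ∼-empty
∼-refl (node l r) = ∼-straight (∼-refl l) (∼-refl r)

∼-sym : s ∼ t → t ∼ s
∼-sym ∼-empty            = ∼-empty
∼-sym (∼-straight p q) = ∼-straight (∼-sym p) (∼-sym q)
∼-sym (∼-crossed p q)  = ∼-crossed (∼-sym q) (∼-sym p)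

∼-trans : s ∼ t → t ∼ u → s ∼ u
∼-trans ∼-empty          ∼-empty            = ∼-empty
∼-trans (∼-straight p q) (∼-straight p′ q′) = ∼-straight (∼-trans p p′) (∼-trans q q′)
∼-trans (∼-straight p q) (∼-crossed p′ q′)  = ∼-crossed  (∼-trans p p′) (∼-trans q q′)
∼-trans (∼-crossed p q)  (∼-straight p′ q′) = ∼-crossed  (∼-trans p q′) (∼-trans q p′)
∼-trans (∼-crossed p q)  (∼-crossed p′ q′)  = ∼-straight (∼-trans p q′) (∼-trans q p′)

flipEq-isEquivalence : IsEquivalence (λ s t → T (flipEq s t))
flipEq-isEquivalence = record
  { refl  = λ {t} → flipEq-complete (∼-refl t)
  ; sym   = λ {s} {t} p → flipEq-complete (∼-sym (flipEq-sound s t p))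
  ; trans = λ {s} {t} {u} p q → flipEq-complete (∼-trans (flipEq-sound s t p) (flipEq-sound t u q))
  }

flipEq-sym : ∀ s t → flipEq s t ≡ flipEq t s
flipEq-sym s t = T-injective (flipEq-complete ∘ ∼-sym ∘ flipEq-sound s t)
                             (flipEq-complete ∘ ∼-sym ∘ flipEq-sound t s)

flipEq-resp-∼ : a ∼ c → b ∼ d → flipEq a b ≡ flipEq c d
flipEq-resp-∼ {a} {c} {b} {d} a∼c b∼d = T-injective
  (λ h → flipEq-complete (∼-trans (∼-trans (∼-sym a∼c) (flipEq-sound a b h)) b∼d))
  (λ h → flipEq-complete (∼-trans (∼-trans a∼c (flipEq-sound c d h)) (∼-sym b∼d)))

∼⇒size≡ : s ∼ t → size s ≡ size t
∼⇒size≡ ∼-empty            = refl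
∼⇒size≡ (∼-straight p q) = cong suc (cong₂ _+_ (∼⇒size≡ p) (∼⇒size≡ q))
∼⇒size≡ (∼-crossed {d = d} {c = c} p q) =
  cong suc (trans (cong₂ _+_ (∼⇒size≡ p) (∼⇒size≡ q)) (ℕP.+-comm (size d) (size c)))

rootBit : Bool → ℕ
rootBit x = if x then 0 else 1

∼⇒nonEqNodes≡ : s ∼ t → nonEqNodes s ≡ nonEqNodes t
∼⇒nonEqNodes≡ ∼-empty = refl
∼⇒nonEqNodes≡ (∼-straight p q) =
  cong₂ _+_ (cong₂ _+_ (cong rootBit (flipEq-resp-∼ p q)) (∼⇒nonEqNodes≡ p)) (∼⇒nonEqNodes≡ q)
∼⇒nonEqNodes≡ (∼-crossed {d = d} {c = c} p q) =
  trans (cong₂ _+_ (cong₂ _+_ (cong rootBit (trans (flipEq-resp-∼ p q) (flipEq-sym d c))) (∼⇒nonEqNodes≡ p))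
                   (∼⇒nonEqNodes≡ q))
        (xy∙z≈xz∙y (rootBit (flipEq c d)) (nonEqNodes d) (nonEqNodes c))

-- Enumerating trees

All-concatMap⁺ : ∀ {A B : Set} {P : B → Set} {h : A → List B} {xs} → All (All P ∘ h) xs → All P (concatMap h xs)
All-concatMap⁺ = concat⁺ ∘ map⁺

treesUpTo-fuel : ∀ {f g n} → n < f → n < g → treesUpTo f n ≡ treesUpTo g n
treesUpTo-fuel {suc f} {suc g} {zero}  _         _         = refl
treesUpTo-fuel {suc f} {suc g} {suc n} (s≤s n<f) (s≤s n<g) =
  cong concat (map-cong-local (All.map sameSplit (all-upTo (suc n))))
  where
  sameSplit : ∀ {i} → i < suc n →
    concatMap (λ l → map (node l) (treesUpTo f (n ∸ i))) (treesUpTo f i) ≡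
    concatMap (λ l → map (node l) (treesUpTo g (n ∸ i))) (treesUpTo g i)
  sameSplit {i} (s≤s i≤n) = cong₂ (λ ls rs → concatMap (λ l → map (node l) rs) ls)
    (treesUpTo-fuel (ℕP.≤-<-trans i≤n n<f) (ℕP.≤-<-trans i≤n n<g))
    (treesUpTo-fuel (ℕP.≤-<-trans (ℕP.m∸n≤m n i) n<f) (ℕP.≤-<-trans (ℕP.m∸n≤m n i) n<g))

treesUpTo-size : ∀ {f n} → n < f → All (λ t → size t ≡ n) (treesUpTo f n)
treesUpTo-size {suc f} {zero}  _         = refl ∷ []
treesUpTo-size {suc f} {suc n} (s≤s n<f) = All-concatMap⁺ (All.map splitSize (all-upTo (suc n)))
  where
  splitSize : ∀ {i} → i < suc n →
    All (λ t → size t ≡ suc n) (concatMap (λ l → map (node l) (treesUpTo f (n ∸ i))) (treesUpTo f i))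
  splitSize {i} (s≤s i≤n) = All-concatMap⁺ (All.map (λ ∣l∣≡i → map⁺ (All.map
    (λ ∣r∣≡n∸i → cong suc (trans (cong₂ _+_ ∣l∣≡i ∣r∣≡n∸i) (ℕP.m+[n∸m]≡n i≤n)))
    (treesUpTo-size (ℕP.≤-<-trans (ℕP.m∸n≤m n i) n<f))))
    (treesUpTo-size (ℕP.≤-<-trans i≤n n<f)))

allTrees-size : ∀ n → All (λ t → size t ≡ n) (allTrees n)
allTrees-size n = treesUpTo-size ℕP.≤-refl

allTrees-suc : ∀ m → allTrees (suc m) ≡
  concatMap (λ i → concatMap (λ l → map (node l) (allTrees (m ∸ i))) (allTrees i)) (upTo (suc m))
allTrees-suc m = cong concat (map-cong-local (All.map exactFuel (all-upTo (suc m))))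
  where
  exactFuel : ∀ {i} → i < suc m →
    concatMap (λ l → map (node l) (treesUpTo (suc m) (m ∸ i))) (treesUpTo (suc m) i) ≡
    concatMap (λ l → map (node l) (allTrees (m ∸ i))) (allTrees i)
  exactFuel {i} i<sm = cong₂ (λ ls rs → concatMap (λ l → map (node l) rs) ls)
    (treesUpTo-fuel i<sm ℕP.≤-refl)
    (treesUpTo-fuel (s≤s (ℕP.m∸n≤m m i)) ℕP.≤-refl)

∑Pairs : ℕ → (Tree → Tree → ℕ) → ℕ
∑Pairs m G = ∑ (λ i → ∑ (λ l → ∑ (G l) (allTrees (m ∸ i))) (allTrees i)) (upTo (suc m))

∑-allTrees-suc : ∀ m (F : Tree → ℕ) → ∑ F (allTrees (suc m)) ≡ ∑Pairs m (λ l r → F (node l r))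
∑-allTrees-suc m F = begin
  ∑ F (allTrees (suc m))
    ≡⟨ cong (∑ F) (allTrees-suc m) ⟩
  ∑ F (concatMap (λ i → concatMap (λ l → map (node l) (allTrees (m ∸ i))) (allTrees i)) (upTo (suc m)))
    ≡⟨ ∑-concatMap {f = F} (λ i → concatMap (λ l → map (node l) (allTrees (m ∸ i))) (allTrees i)) (upTo (suc m)) ⟩
  ∑ (λ i → ∑ F (concatMap (λ l → map (node l) (allTrees (m ∸ i))) (allTrees i))) (upTo (suc m))
    ≡⟨ ∑-cong (λ i → trans (∑-concatMap {f = F} (λ l → map (node l) (allTrees (m ∸ i))) (allTrees i))
                           (∑-cong (λ l → ∑-map {f = F} (node l) (allTrees (m ∸ i))) (allTrees i)))
              (upTo (suc m)) ⟩
  ∑Pairs m (λ l r → F (node l r)) ∎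
  where open ≡-Reasoning

∑Pairs-cong : ∀ m {G H : Tree → Tree → ℕ} → (∀ l r → G l r ≡ H l r) → ∑Pairs m G ≡ ∑Pairs m H
∑Pairs-cong m G≡H =
  ∑-cong (λ i → ∑-cong (λ l → ∑-cong (G≡H l) (allTrees (m ∸ i))) (allTrees i)) (upTo (suc m))

∑Pairs-+ : ∀ m (G H : Tree → Tree → ℕ) → ∑Pairs m (λ l r → G l r + H l r) ≡ ∑Pairs m G + ∑Pairs m H
∑Pairs-+ m G H = trans (∑-cong (λ i → trans (∑-cong (λ l → ∑-+ (allTrees (m ∸ i))) (allTrees i))
                                            (∑-+ (allTrees i)))
                                (upTo (suc m)))
                       (∑-+ {f = λ i → ∑ (λ l → ∑ (G l) (allTrees (m ∸ i))) (allTrees i)} (upTo (suc m)))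

∑Pairs-product : ∀ m (f g : Tree → ℕ) → ∑Pairs m (λ l r → f l * g r) ≡
  ∑ (λ i → ∑ f (allTrees i) * ∑ g (allTrees (m ∸ i))) (upTo (suc m))
∑Pairs-product m f g = ∑-cong (λ i → ∑-product (allTrees i) (allTrees (m ∸ i))) (upTo (suc m))

-- Flip-equivalence classes

count-∼-allTrees-≢ : ∀ {d n} → size d ≢ n → count (flipEq d) (allTrees n) ≡ 0
count-∼-allTrees-≢ {d} {n} ∣d∣≢n = ∑-zeroᴬ (All.map
  (λ {t} ∣t∣≡n → 𝟙-¬T (λ d∼t → ∣d∣≢n (trans (∼⇒size≡ (flipEq-sound d t d∼t)) ∣t∣≡n)))
  (allTrees-size n))

classSize : Tree → ℕ
classSize d = count (flipEq d) (allTrees (size d))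

∑Pairs-matching : ∀ a b {m} → m ≡ size a + size b →
  classSize a ≡ 2 ^ nonEqNodes a → classSize b ≡ 2 ^ nonEqNodes b →
  ∑Pairs m (λ l r → 𝟙 (flipEq a l) * 𝟙 (flipEq b r)) ≡ 2 ^ nonEqNodes a * 2 ^ nonEqNodes b
∑Pairs-matching a b refl ∣[a]∣ ∣[b]∣ = begin
  ∑Pairs m (λ l r → 𝟙 (flipEq a l) * 𝟙 (flipEq b r))
    ≡⟨ ∑Pairs-product m (𝟙 ∘ flipEq a) (𝟙 ∘ flipEq b) ⟩
  ∑ (λ i → count (flipEq a) (allTrees i) * count (flipEq b) (allTrees (m ∸ i))) (upTo (suc m))
    ≡⟨ ∑-upTo-collapse (λ i → count (flipEq a) (allTrees i) * count (flipEq b) (allTrees (m ∸ i)))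
                       (s≤s (ℕP.m≤m+n (size a) (size b)))
                       (λ {i} _ i≢∣a∣ → cong (_* count (flipEq b) (allTrees (m ∸ i)))
                                             (count-∼-allTrees-≢ (i≢∣a∣ ∘ sym))) ⟩
  classSize a * count (flipEq b) (allTrees (m ∸ size a))
    ≡⟨ cong (λ n → classSize a * count (flipEq b) (allTrees n)) (ℕP.m+n∸m≡n (size a) (size b)) ⟩
  classSize a * classSize b
    ≡⟨ cong₂ _*_ ∣[a]∣ ∣[b]∣ ⟩
  2 ^ nonEqNodes a * 2 ^ nonEqNodes b ∎
  where
  open ≡-Reasoning
  m = size a + size b

classSize-symmetric : ∀ a b → a ∼ b → classSize a ≡ 2 ^ nonEqNodes a → classSize b ≡ 2 ^ nonEqNodes b →
                      classSize (node a b) ≡ 2 ^ (nonEqNodes a + nonEqNodes b)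
classSize-symmetric a b a∼b ∣[a]∣ ∣[b]∣ = begin
  classSize (node a b)
    ≡⟨ ∑-allTrees-suc m (𝟙 ∘ flipEq (node a b)) ⟩
  ∑Pairs m (λ l r → 𝟙 (flipEq (node a b) (node l r)))
    ≡⟨ ∑Pairs-cong m (λ l r → trans (𝟙-∨-absorb _ _ (crossed⇒straight l r)) (𝟙-∧ (flipEq a l) (flipEq b r))) ⟩
  ∑Pairs m (λ l r → 𝟙 (flipEq a l) * 𝟙 (flipEq b r))
    ≡⟨ ∑Pairs-matching a b refl ∣[a]∣ ∣[b]∣ ⟩
  2 ^ nonEqNodes a * 2 ^ nonEqNodes b
    ≡⟨ sym (ℕP.^-distribˡ-+-* 2 (nonEqNodes a) (nonEqNodes b)) ⟩
  2 ^ (nonEqNodes a + nonEqNodes b) ∎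
  where
  open ≡-Reasoning
  m : ℕ
  m = size a + size b
  crossed⇒straight : ∀ l r → T (flipEq a r ∧ flipEq b l) → T (flipEq a l ∧ flipEq b r)
  crossed⇒straight l r h =
    let (a∼r , b∼l) = Equivalence.to (T-∧ {flipEq a r}) h
    in Equivalence.from T-∧ ( flipEq-complete (∼-trans a∼b (flipEq-sound b l b∼l))
                            , flipEq-complete (∼-trans (∼-sym a∼b) (flipEq-sound a r a∼r)))

classSize-asymmetric : ∀ a b → ¬ a ∼ b → classSize a ≡ 2 ^ nonEqNodes a → classSize b ≡ 2 ^ nonEqNodes b →
                       classSize (node a b) ≡ 2 ^ (1 + nonEqNodes a + nonEqNodes b)
classSize-asymmetric a b a≁b ∣[a]∣ ∣[b]∣ = begin
  classSize (node a b)
    ≡⟨ ∑-allTrees-suc m (𝟙 ∘ flipEq (node a b)) ⟩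
  ∑Pairs m (λ l r → 𝟙 (flipEq (node a b) (node l r)))
    ≡⟨ ∑Pairs-cong m split ⟩
  ∑Pairs m (λ l r → 𝟙 (flipEq a l) * 𝟙 (flipEq b r) + 𝟙 (flipEq b l) * 𝟙 (flipEq a r))
    ≡⟨ ∑Pairs-+ m (λ l r → 𝟙 (flipEq a l) * 𝟙 (flipEq b r)) (λ l r → 𝟙 (flipEq b l) * 𝟙 (flipEq a r)) ⟩
  ∑Pairs m (λ l r → 𝟙 (flipEq a l) * 𝟙 (flipEq b r)) + ∑Pairs m (λ l r → 𝟙 (flipEq b l) * 𝟙 (flipEq a r))
    ≡⟨ cong₂ _+_ (∑Pairs-matching a b refl ∣[a]∣ ∣[b]∣)
                 (∑Pairs-matching b a (ℕP.+-comm (size a) (size b)) ∣[b]∣ ∣[a]∣) ⟩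
  2 ^ nonEqNodes a * 2 ^ nonEqNodes b + 2 ^ nonEqNodes b * 2 ^ nonEqNodes a
    ≡⟨ cong₂ _+_ (sym (ℕP.^-distribˡ-+-* 2 (nonEqNodes a) (nonEqNodes b)))
                 (trans (ℕP.*-comm (2 ^ nonEqNodes b) _) (sym (ℕP.^-distribˡ-+-* 2 (nonEqNodes a) (nonEqNodes b)))) ⟩
  2 ^ (nonEqNodes a + nonEqNodes b) + 2 ^ (nonEqNodes a + nonEqNodes b)
    ≡⟨ cong (2 ^ (nonEqNodes a + nonEqNodes b) +_) (sym (ℕP.+-identityʳ _)) ⟩
  2 ^ (1 + nonEqNodes a + nonEqNodes b) ∎
  where
  open ≡-Reasoning
  m : ℕ
  m = size a + size b
  notStraightAndCrossed : ∀ l r → T (flipEq a l ∧ flipEq b r) → T (flipEq a r ∧ flipEq b l) → ⊥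
  notStraightAndCrossed l r h k =
    let (_ , b∼r) = Equivalence.to (T-∧ {flipEq a l}) h
        (a∼r , _) = Equivalence.to (T-∧ {flipEq a r}) k
    in a≁b (∼-trans (flipEq-sound a r a∼r) (∼-sym (flipEq-sound b r b∼r)))
  split : ∀ l r → 𝟙 (flipEq (node a b) (node l r)) ≡ 𝟙 (flipEq a l) * 𝟙 (flipEq b r) + 𝟙 (flipEq b l) * 𝟙 (flipEq a r)
  split l r = trans (𝟙-∨-disjoint _ _ (notStraightAndCrossed l r))
                    (cong₂ _+_ (𝟙-∧ (flipEq a l) (flipEq b r))
                               (trans (𝟙-∧ (flipEq a r) (flipEq b l)) (ℕP.*-comm (𝟙 (flipEq a r)) _)))

classSize-node : ∀ a b → classSize a ≡ 2 ^ nonEqNodes a → classSize b ≡ 2 ^ nonEqNodes b →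
                 classSize (node a b) ≡ 2 ^ nonEqNodes (node a b)
classSize-node a b ∣[a]∣ ∣[b]∣ with flipEq a b in a≟b
... | true  = classSize-symmetric a b (flipEq-sound a b (Equivalence.from T-≡ a≟b)) ∣[a]∣ ∣[b]∣
... | false = classSize-asymmetric a b (λ a∼b → subst T a≟b (flipEq-complete a∼b)) ∣[a]∣ ∣[b]∣

classSize≡2^nonEqNodes : ∀ d → classSize d ≡ 2 ^ nonEqNodes d
classSize≡2^nonEqNodes empty      = refl
classSize≡2^nonEqNodes (node a b) =
  classSize-node a b (classSize≡2^nonEqNodes a) (classSize≡2^nonEqNodes b)

count-∼-allTrees : ∀ d n → count (flipEq d) (allTrees n) ≡ 𝟙 (size d ≡ᵇ n) * 2 ^ nonEqNodes d
count-∼-allTrees d n with size d ≟ n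
... | yes refl = trans (classSize≡2^nonEqNodes d)
                       (sym (trans (cong (_* 2 ^ nonEqNodes d) (𝟙-≡ᵇ {size d} refl)) (ℕP.*-identityˡ _)))
... | no ∣d∣≢n = trans (count-∼-allTrees-≢ ∣d∣≢n) (sym (cong (_* 2 ^ nonEqNodes d) (𝟙-≢ᵇ ∣d∣≢n)))

orderedTreeCount : ℕ → ℕ → ℕ
orderedTreeCount n ℓ = count (λ t → nonEqNodes t ≡ᵇ ℓ) (allTrees n)

orderedTreeCount≡K*2^ℓ : ∀ n ℓ → orderedTreeCount n ℓ ≡ K n ℓ * 2 ^ ℓ
orderedTreeCount≡K*2^ℓ n ℓ = begin
  orderedTreeCount n ℓ
    ≡⟨ sym (length-filterᵇ P (allTrees n)) ⟩
  length S
    ≡⟨ length≡∑-classSizeIn S ⟩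
  ∑ (λ d → classSizeIn d S) (representatives S)
    ≡⟨ ∑-congᴬ (All.map classSizeIn-S (deduplicate⁺ _ (All.zip (filter⁺ _ (allTrees-size n) , all-filter _ (allTrees n))))) ⟩
  ∑ (λ _ → 2 ^ ℓ) (representatives S)
    ≡⟨ ∑-const (2 ^ ℓ) (representatives S) ⟩
  K n ℓ * 2 ^ ℓ ∎
  where
  open ≡-Reasoning
  open Deduplicate flipEq-isEquivalence (λ s t → T? (flipEq s t))
  P : Tree → Bool
  P t = nonEqNodes t ≡ᵇ ℓ
  S : List Tree
  S = filterᵇ P (allTrees n)
  classSizeIn-S : ∀ {d} → size d ≡ n × T (P d) → classSizeIn d S ≡ 2 ^ ℓ
  classSizeIn-S {d} (∣d∣≡n , Pd) = begin
    classSizeIn d S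
      ≡⟨ ∑-filter (T? ∘ P) (𝟙 ∘ flipEq d) (allTrees n) ⟩
    ∑ (λ t → 𝟙 (P t) * 𝟙 (flipEq d t)) (allTrees n)
      ≡⟨ ∑-cong (λ t → 𝟙-*-absorbˡ (P t) (flipEq d t) (λ d∼t →
                         subst (T ∘ (_≡ᵇ ℓ)) (∼⇒nonEqNodes≡ (flipEq-sound d t d∼t)) Pd))
                (allTrees n) ⟩
    count (flipEq d) (allTrees n)
      ≡⟨ cong (λ m → count (flipEq d) (allTrees m)) (sym ∣d∣≡n) ⟩
    classSize d
      ≡⟨ classSize≡2^nonEqNodes d ⟩
    2 ^ nonEqNodes d
      ≡⟨ cong (2 ^_) (ℕP.≡ᵇ⇒≡ (nonEqNodes d) ℓ Pd) ⟩
    2 ^ ℓ ∎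

isEven-double : ∀ h → T (isEven (h + h))
isEven-double zero    = _
isEven-double (suc h) rewrite ℕP.+-suc h h = isEven-double h

even⇒half+half : ∀ k → T (isEven k) → ⌊ k /2⌋ + ⌊ k /2⌋ ≡ k
even⇒half+half zero          _ = refl
even⇒half+half (suc (suc k)) e =
  cong suc (trans (ℕP.+-suc ⌊ k /2⌋ ⌊ k /2⌋) (cong suc (even⇒half+half k e)))

≡ᵇ-resp-⇔ : ∀ {m n m′ n′} → (m ≡ n → m′ ≡ n′) → (m′ ≡ n′ → m ≡ n) →
            (m ≡ᵇ n) ≡ (m′ ≡ᵇ n′)
≡ᵇ-resp-⇔ {m} {n} {m′} {n′} to from =
  T-injective (ℕP.≡⇒≡ᵇ m′ n′ ∘ to ∘ ℕP.≡ᵇ⇒≡ m n)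
              (ℕP.≡⇒≡ᵇ m n ∘ from ∘ ℕP.≡ᵇ⇒≡ m′ n′)

≡ᵇ-comm : ∀ m n → (m ≡ᵇ n) ≡ (n ≡ᵇ m)
≡ᵇ-comm m n = ≡ᵇ-resp-⇔ {m} {n} {n} {m} sym sym

double≡ᵇ : ∀ h k → (h + h ≡ᵇ k) ≡ (isEven k ∧ (h ≡ᵇ ⌊ k /2⌋))
double≡ᵇ h k = T-injective
  (λ h+h≡ᵇk → let h+h≡k = ℕP.≡ᵇ⇒≡ (h + h) k h+h≡ᵇk in
    Equivalence.from T-∧ ( subst (T ∘ isEven) h+h≡k (isEven-double h)
                         , ℕP.≡⇒≡ᵇ h ⌊ k /2⌋ (trans (ℕP.n≡⌊n+n/2⌋ h) (cong ⌊_/2⌋ h+h≡k))))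
  (λ even∧half → let (even , h≡ᵇhalf) = Equivalence.to (T-∧ {isEven k}) even∧half in
    ℕP.≡⇒≡ᵇ (h + h) k (subst (λ x → x + x ≡ k) (sym (ℕP.≡ᵇ⇒≡ h ⌊ k /2⌋ h≡ᵇhalf))
                             (even⇒half+half k even)))

∑-upTo-𝟙≡ᵇ : ∀ (G : ℕ → ℕ) {n p} → p < n → ∑ (λ i → 𝟙 (i ≡ᵇ p) * G i) (upTo n) ≡ G p
∑-upTo-𝟙≡ᵇ G {n} {p} p<n =
  trans (∑-upTo-collapse (λ i → 𝟙 (i ≡ᵇ p) * G i) p<n (λ {i} _ i≢p → cong (_* G i) (𝟙-≢ᵇ i≢p)))
        (trans (cong (_* G p) (𝟙-≡ᵇ {p} refl)) (ℕP.*-identityˡ (G p)))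

∑-upTo-𝟙[i≡m∸i] : ∀ m (G : ℕ → ℕ) →
  ∑ (λ i → 𝟙 (i ≡ᵇ m ∸ i) * G i) (upTo (suc m)) ≡ 𝟙 (isEven m) * G ⌊ m /2⌋
∑-upTo-𝟙[i≡m∸i] m G = begin
  ∑ (λ i → 𝟙 (i ≡ᵇ m ∸ i) * G i) (upTo (suc m))
    ≡⟨ ∑-upTo-cong (suc m) (λ {i} i<1+m → cong (λ b → 𝟙 b * G i) (trans (≡ᵇ-resp-⇔ 
         (λ i≡m∸i → trans (cong (i +_) i≡m∸i) (ℕP.m+[n∸m]≡n (ℕP.≤-pred i<1+m)))
         (λ i+i≡m → trans (sym (ℕP.m+n∸m≡n i i)) (cong (_∸ i) i+i≡m)))
         (double≡ᵇ i m))) ⟩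
  ∑ (λ i → 𝟙 (isEven m ∧ (i ≡ᵇ ⌊ m /2⌋)) * G i) (upTo (suc m))
    ≡⟨ ∑-cong (λ i → trans (cong (_* G i) (𝟙-∧ (isEven m) (i ≡ᵇ ⌊ m /2⌋))) (ℕP.*-assoc (𝟙 (isEven m)) _ _))
              (upTo (suc m)) ⟩
  ∑ (λ i → 𝟙 (isEven m) * (𝟙 (i ≡ᵇ ⌊ m /2⌋) * G i)) (upTo (suc m))
    ≡⟨ ∑-*ˡ (𝟙 (isEven m)) (upTo (suc m)) ⟩
  𝟙 (isEven m) * ∑ (λ i → 𝟙 (i ≡ᵇ ⌊ m /2⌋) * G i) (upTo (suc m))
    ≡⟨ cong (𝟙 (isEven m) *_) (∑-upTo-𝟙≡ᵇ G (s≤s (ℕP.⌊n/2⌋≤n m))) ⟩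
  𝟙 (isEven m) * G ⌊ m /2⌋ ∎
  where open ≡-Reasoning

𝟙-+≡ᵇ : ∀ x y k → 𝟙 (x + y ≡ᵇ k) ≡ ∑ (λ a → 𝟙 (x ≡ᵇ a) * 𝟙 (y ≡ᵇ k ∸ a)) (upTo (suc k))
𝟙-+≡ᵇ x y k with x ℕP.≤? k
... | yes x≤k = sym (begin
  ∑ (λ a → 𝟙 (x ≡ᵇ a) * 𝟙 (y ≡ᵇ k ∸ a)) (upTo (suc k))
    ≡⟨ ∑-cong (λ a → cong (λ b → 𝟙 b * 𝟙 (y ≡ᵇ k ∸ a)) (≡ᵇ-comm x a)) (upTo (suc k)) ⟩
  ∑ (λ a → 𝟙 (a ≡ᵇ x) * 𝟙 (y ≡ᵇ k ∸ a)) (upTo (suc k))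
    ≡⟨ ∑-upTo-𝟙≡ᵇ (λ a → 𝟙 (y ≡ᵇ k ∸ a)) (s≤s x≤k) ⟩
  𝟙 (y ≡ᵇ k ∸ x)
    ≡⟨ cong 𝟙 (≡ᵇ-resp-⇔ (λ y≡k∸x → trans (cong (x +_) y≡k∸x) (ℕP.m+[n∸m]≡n x≤k))
                         (λ x+y≡k → trans (sym (ℕP.m+n∸m≡n x y)) (cong (_∸ x) x+y≡k))) ⟩
  𝟙 (x + y ≡ᵇ k) ∎)
  where open ≡-Reasoning
... | no x≰k = trans (𝟙-≢ᵇ (λ x+y≡k → x≰k (subst (x ≤_) x+y≡k (ℕP.m≤m+n x y))))
  (sym (∑-zeroᴬ (All.map (λ {a} a<1+k → cong (_* 𝟙 (y ≡ᵇ k ∸ a))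
                                          (𝟙-≢ᵇ (λ x≡a → x≰k (subst (_≤ k) (sym x≡a) (ℕP.≤-pred a<1+k)))))
                         (all-upTo (suc k)))))

-- The recurrence for K

infixl 7 _⊛_
_⊛_ : (ℕ → ℕ → ℕ) → (ℕ → ℕ → ℕ) → ℕ → ℕ → ℕ
(f ⊛ g) n ℓ = ∑ (λ i → ∑ (λ j → f i j * g (n ∸ i) (ℓ ∸ j)) (upTo (suc ℓ))) (upTo (suc n))

squareVarsℕ : (ℕ → ℕ → ℕ) → ℕ → ℕ → ℕ
squareVarsℕ f n ℓ = if isEven n ∧ isEven ℓ then f ⌊ n /2⌋ ⌊ ℓ /2⌋ else 0

squareVarsℕ≡𝟙* : ∀ f n ℓ → squareVarsℕ f n ℓ ≡ 𝟙 (isEven n) * (𝟙 (isEven ℓ) * f ⌊ n /2⌋ ⌊ ℓ /2⌋)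
squareVarsℕ≡𝟙* f n ℓ with isEven n | isEven ℓ
... | true  | true  = sym (trans (ℕP.*-identityˡ _) (ℕP.*-identityˡ _))
... | true  | false = refl
... | false | _     = refl

pairCount : ℕ → ℕ → ℕ
pairCount m k = ∑Pairs m (λ l r → 𝟙 (nonEqNodes l + nonEqNodes r ≡ᵇ k))

symmetricPairCount : ℕ → ℕ → ℕ
symmetricPairCount m k = ∑Pairs m (λ l r → 𝟙 (flipEq l r) * 𝟙 (nonEqNodes l + nonEqNodes r ≡ᵇ k))

∑-allTrees²-𝟙[+≡] : ∀ i j k →
  ∑ (λ l → ∑ (λ r → 𝟙 (nonEqNodes l + nonEqNodes r ≡ᵇ k)) (allTrees j)) (allTrees i) ≡
  ∑ (λ a → orderedTreeCount i a * orderedTreeCount j (k ∸ a)) (upTo (suc k))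
∑-allTrees²-𝟙[+≡] i j k = begin
  ∑ (λ l → ∑ (λ r → 𝟙 (nonEqNodes l + nonEqNodes r ≡ᵇ k)) (allTrees j)) (allTrees i)
    ≡⟨ ∑-cong (λ l → trans (∑-cong (λ r → 𝟙-+≡ᵇ (nonEqNodes l) (nonEqNodes r) k) (allTrees j))
                           (∑-swap (λ r a → split l r a) (allTrees j) (upTo (suc k))))
              (allTrees i) ⟩
  ∑ (λ l → ∑ (λ a → ∑ (λ r → split l r a) (allTrees j)) (upTo (suc k))) (allTrees i)
    ≡⟨ ∑-swap (λ l a → ∑ (λ r → split l r a) (allTrees j)) (allTrees i) (upTo (suc k)) ⟩
  ∑ (λ a → ∑ (λ l → ∑ (λ r → split l r a) (allTrees j)) (allTrees i)) (upTo (suc k))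
    ≡⟨ ∑-cong (λ a → ∑-product (allTrees i) (allTrees j)) (upTo (suc k)) ⟩
  ∑ (λ a → orderedTreeCount i a * orderedTreeCount j (k ∸ a)) (upTo (suc k)) ∎
  where
  open ≡-Reasoning
  split : Tree → Tree → ℕ → ℕ
  split l r a = 𝟙 (nonEqNodes l ≡ᵇ a) * 𝟙 (nonEqNodes r ≡ᵇ k ∸ a)

pairCount≡ : ∀ m k → pairCount m k ≡ (K ⊛ K) m k * 2 ^ k
pairCount≡ m k = begin
  pairCount m k
    ≡⟨ ∑-cong (λ i → ∑-allTrees²-𝟙[+≡] i (m ∸ i) k) (upTo (suc m)) ⟩
  ∑ (λ i → ∑ (λ a → orderedTreeCount i a * orderedTreeCount (m ∸ i) (k ∸ a)) (upTo (suc k))) (upTo (suc m))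
    ≡⟨ ∑-cong (λ i → trans (∑-upTo-cong (suc k) (λ a<1+k → weights i (ℕP.≤-pred a<1+k)))
                           (∑-*ʳ {f = λ a → K i a * K (m ∸ i) (k ∸ a)} (2 ^ k) (upTo (suc k))))
              (upTo (suc m)) ⟩
  ∑ (λ i → ∑ (λ a → K i a * K (m ∸ i) (k ∸ a)) (upTo (suc k)) * 2 ^ k) (upTo (suc m))
    ≡⟨ ∑-*ʳ {f = λ i → ∑ (λ a → K i a * K (m ∸ i) (k ∸ a)) (upTo (suc k))} (2 ^ k) (upTo (suc m)) ⟩
  (K ⊛ K) m k * 2 ^ k ∎
  where
  open ≡-Reasoning
  weights : ∀ i {a} → a ≤ k →
    orderedTreeCount i a * orderedTreeCount (m ∸ i) (k ∸ a) ≡ K i a * K (m ∸ i) (k ∸ a) * 2 ^ k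
  weights i {a} a≤k = begin
    orderedTreeCount i a * orderedTreeCount (m ∸ i) (k ∸ a)
      ≡⟨ cong₂ _*_ (orderedTreeCount≡K*2^ℓ i a) (orderedTreeCount≡K*2^ℓ (m ∸ i) (k ∸ a)) ⟩
    K i a * 2 ^ a * (K (m ∸ i) (k ∸ a) * 2 ^ (k ∸ a))
      ≡⟨ *-interchange (K i a) (2 ^ a) (K (m ∸ i) (k ∸ a)) (2 ^ (k ∸ a)) ⟩
    K i a * K (m ∸ i) (k ∸ a) * (2 ^ a * 2 ^ (k ∸ a))
      ≡⟨ cong (K i a * K (m ∸ i) (k ∸ a) *_) (trans (sym (ℕP.^-distribˡ-+-* 2 a (k ∸ a)))
                                                     (cong (2 ^_) (ℕP.m+[n∸m]≡n a≤k))) ⟩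
    K i a * K (m ∸ i) (k ∸ a) * 2 ^ k ∎

∑-allTrees-𝟙[∼]*𝟙[+≡] : ∀ {l i} → size l ≡ i → ∀ j k →
  ∑ (λ r → 𝟙 (flipEq l r) * 𝟙 (nonEqNodes l + nonEqNodes r ≡ᵇ k)) (allTrees j) ≡
  𝟙 (i ≡ᵇ j) * (𝟙 (nonEqNodes l + nonEqNodes l ≡ᵇ k) * 2 ^ nonEqNodes l)
∑-allTrees-𝟙[∼]*𝟙[+≡] {l} refl j k = begin
  ∑ (λ r → 𝟙 (flipEq l r) * 𝟙 (nonEqNodes l + nonEqNodes r ≡ᵇ k)) (allTrees j)
    ≡⟨ ∑-cong (λ r → trans (𝟙-*-cong (flipEq l r) (λ l∼r →
                             cong (λ n → 𝟙 (nonEqNodes l + n ≡ᵇ k)) (sym (∼⇒nonEqNodes≡ (flipEq-sound l r l∼r)))))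
                           (ℕP.*-comm (𝟙 (flipEq l r)) _))
              (allTrees j) ⟩
  ∑ (λ r → 𝟙 (nonEqNodes l + nonEqNodes l ≡ᵇ k) * 𝟙 (flipEq l r)) (allTrees j)
    ≡⟨ ∑-*ˡ (𝟙 (nonEqNodes l + nonEqNodes l ≡ᵇ k)) (allTrees j) ⟩
  𝟙 (nonEqNodes l + nonEqNodes l ≡ᵇ k) * count (flipEq l) (allTrees j)
    ≡⟨ cong (𝟙 (nonEqNodes l + nonEqNodes l ≡ᵇ k) *_) (count-∼-allTrees l j) ⟩
  𝟙 (nonEqNodes l + nonEqNodes l ≡ᵇ k) * (𝟙 (size l ≡ᵇ j) * 2 ^ nonEqNodes l)
    ≡⟨ x∙yz≈y∙xz (𝟙 (nonEqNodes l + nonEqNodes l ≡ᵇ k)) (𝟙 (size l ≡ᵇ j)) _ ⟩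
  𝟙 (size l ≡ᵇ j) * (𝟙 (nonEqNodes l + nonEqNodes l ≡ᵇ k) * 2 ^ nonEqNodes l) ∎
  where open ≡-Reasoning

∑-allTrees-𝟙[+≡]*2^ : ∀ h k →
  ∑ (λ l → 𝟙 (nonEqNodes l + nonEqNodes l ≡ᵇ k) * 2 ^ nonEqNodes l) (allTrees h) ≡
  𝟙 (isEven k) * (K h ⌊ k /2⌋ * 2 ^ k)
∑-allTrees-𝟙[+≡]*2^ h k = begin
  ∑ (λ l → 𝟙 (nonEqNodes l + nonEqNodes l ≡ᵇ k) * 2 ^ nonEqNodes l) (allTrees h)
    ≡⟨ ∑-cong halfWeight (allTrees h) ⟩
  ∑ (λ l → 𝟙 (isEven k) * (𝟙 (nonEqNodes l ≡ᵇ ⌊ k /2⌋) * 2 ^ ⌊ k /2⌋)) (allTrees h)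
    ≡⟨ trans (∑-*ˡ (𝟙 (isEven k)) (allTrees h)) (cong (𝟙 (isEven k) *_) (∑-*ʳ (2 ^ ⌊ k /2⌋) (allTrees h))) ⟩
  𝟙 (isEven k) * (orderedTreeCount h ⌊ k /2⌋ * 2 ^ ⌊ k /2⌋)
    ≡⟨ cong (λ n → 𝟙 (isEven k) * (n * 2 ^ ⌊ k /2⌋)) (orderedTreeCount≡K*2^ℓ h ⌊ k /2⌋) ⟩
  𝟙 (isEven k) * (K h ⌊ k /2⌋ * 2 ^ ⌊ k /2⌋ * 2 ^ ⌊ k /2⌋)
    ≡⟨ 𝟙-*-cong (isEven k) (λ even → trans (ℕP.*-assoc (K h ⌊ k /2⌋) _ _)
         (cong (K h ⌊ k /2⌋ *_) (trans (sym (ℕP.^-distribˡ-+-* 2 ⌊ k /2⌋ ⌊ k /2⌋))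
                                       (cong (2 ^_) (even⇒half+half k even))))) ⟩
  𝟙 (isEven k) * (K h ⌊ k /2⌋ * 2 ^ k) ∎
  where
  open ≡-Reasoning
  halfWeight : ∀ l → 𝟙 (nonEqNodes l + nonEqNodes l ≡ᵇ k) * 2 ^ nonEqNodes l ≡
                     𝟙 (isEven k) * (𝟙 (nonEqNodes l ≡ᵇ ⌊ k /2⌋) * 2 ^ ⌊ k /2⌋)
  halfWeight l = begin
    𝟙 (nonEqNodes l + nonEqNodes l ≡ᵇ k) * 2 ^ nonEqNodes l
      ≡⟨ cong (λ b → 𝟙 b * 2 ^ nonEqNodes l) (double≡ᵇ (nonEqNodes l) k) ⟩
    𝟙 (isEven k ∧ (nonEqNodes l ≡ᵇ ⌊ k /2⌋)) * 2 ^ nonEqNodes l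
      ≡⟨ trans (cong (_* 2 ^ nonEqNodes l) (𝟙-∧ (isEven k) _)) (ℕP.*-assoc (𝟙 (isEven k)) _ _) ⟩
    𝟙 (isEven k) * (𝟙 (nonEqNodes l ≡ᵇ ⌊ k /2⌋) * 2 ^ nonEqNodes l)
      ≡⟨ cong (𝟙 (isEven k) *_) (𝟙-*-cong (nonEqNodes l ≡ᵇ ⌊ k /2⌋)
                                           (cong (2 ^_) ∘ ℕP.≡ᵇ⇒≡ (nonEqNodes l) ⌊ k /2⌋)) ⟩
    𝟙 (isEven k) * (𝟙 (nonEqNodes l ≡ᵇ ⌊ k /2⌋) * 2 ^ ⌊ k /2⌋) ∎

-- A pair l ∼ r has size l = size r and nonEqNodes l = nonEqNodes r, and each l has
-- 2 ^ nonEqNodes l partners r: this is where L(x², y²) comes from.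
symmetricPairCount≡ : ∀ m k → symmetricPairCount m k ≡ squareVarsℕ K m k * 2 ^ k
symmetricPairCount≡ m k = begin
  symmetricPairCount m k
    ≡⟨ ∑-cong (λ i → trans (∑-congᴬ (All.map (λ ∣l∣≡i → ∑-allTrees-𝟙[∼]*𝟙[+≡] ∣l∣≡i (m ∸ i) k)
                                             (allTrees-size i)))
                           (∑-*ˡ (𝟙 (i ≡ᵇ m ∸ i)) (allTrees i)))
              (upTo (suc m)) ⟩
  ∑ (λ i → 𝟙 (i ≡ᵇ m ∸ i) * G i) (upTo (suc m))
    ≡⟨ ∑-upTo-𝟙[i≡m∸i] m G ⟩
  𝟙 (isEven m) * G ⌊ m /2⌋
    ≡⟨ cong (𝟙 (isEven m) *_) (∑-allTrees-𝟙[+≡]*2^ ⌊ m /2⌋ k) ⟩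
  𝟙 (isEven m) * (𝟙 (isEven k) * (K ⌊ m /2⌋ ⌊ k /2⌋ * 2 ^ k))
    ≡⟨ reassociate (𝟙 (isEven m)) (𝟙 (isEven k)) (K ⌊ m /2⌋ ⌊ k /2⌋) (2 ^ k) ⟩
  𝟙 (isEven m) * (𝟙 (isEven k) * K ⌊ m /2⌋ ⌊ k /2⌋) * 2 ^ k
    ≡⟨ cong (_* 2 ^ k) (sym (squareVarsℕ≡𝟙* K m k)) ⟩
  squareVarsℕ K m k * 2 ^ k ∎
  where
  open ≡-Reasoning
  G : ℕ → ℕ
  G i = ∑ (λ l → 𝟙 (nonEqNodes l + nonEqNodes l ≡ᵇ k) * 2 ^ nonEqNodes l) (allTrees i)
  reassociate : ∀ p q x y → p * (q * (x * y)) ≡ p * (q * x) * y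
  reassociate = solve-∀

𝟙-rootBit+≡ᵇzero : ∀ x p q → 𝟙 (rootBit x + p + q ≡ᵇ 0) ≡ 𝟙 x * 𝟙 (p + q ≡ᵇ 0)
𝟙-rootBit+≡ᵇzero true  p q = sym (ℕP.+-identityʳ _)
𝟙-rootBit+≡ᵇzero false p q = refl

-- The root of node l r counts towards nonEqNodes exactly when l ≁ r; the identity is
-- stated with both sides moved so that no subtraction occurs.
𝟙-rootBit+≡ᵇsuc : ∀ x p q k →
  𝟙 (rootBit x + p + q ≡ᵇ suc k) + 𝟙 x * 𝟙 (p + q ≡ᵇ k) ≡ 𝟙 (p + q ≡ᵇ k) + 𝟙 x * 𝟙 (p + q ≡ᵇ suc k)
𝟙-rootBit+≡ᵇsuc true  p q k = begin
  𝟙 (p + q ≡ᵇ suc k) + (𝟙 (p + q ≡ᵇ k) + 0) ≡⟨ cong (𝟙 (p + q ≡ᵇ suc k) +_) (ℕP.+-identityʳ _) ⟩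
  𝟙 (p + q ≡ᵇ suc k) + 𝟙 (p + q ≡ᵇ k)       ≡⟨ ℕP.+-comm (𝟙 (p + q ≡ᵇ suc k)) _ ⟩
  𝟙 (p + q ≡ᵇ k) + 𝟙 (p + q ≡ᵇ suc k)       ≡⟨ cong (𝟙 (p + q ≡ᵇ k) +_) (sym (ℕP.+-identityʳ _)) ⟩
  𝟙 (p + q ≡ᵇ k) + (𝟙 (p + q ≡ᵇ suc k) + 0) ∎
  where open ≡-Reasoning
𝟙-rootBit+≡ᵇsuc false p q k = refl

orderedTreeCount-suc-zero : ∀ m → orderedTreeCount (suc m) 0 ≡ symmetricPairCount m 0
orderedTreeCount-suc-zero m = trans (∑-allTrees-suc m (λ t → 𝟙 (nonEqNodes t ≡ᵇ 0)))
  (∑Pairs-cong m λ l r → 𝟙-rootBit+≡ᵇzero (flipEq l r) (nonEqNodes l) (nonEqNodes r))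

orderedTreeCount-suc-suc : ∀ m k →
  orderedTreeCount (suc m) (suc k) + symmetricPairCount m k ≡ pairCount m k + symmetricPairCount m (suc k)
orderedTreeCount-suc-suc m k = begin
  orderedTreeCount (suc m) (suc k) + symmetricPairCount m k
    ≡⟨ cong (_+ symmetricPairCount m k) (∑-allTrees-suc m (λ t → 𝟙 (nonEqNodes t ≡ᵇ suc k))) ⟩
  ∑Pairs m (λ l r → 𝟙 (nonEqNodes (node l r) ≡ᵇ suc k)) + symmetricPairCount m k
    ≡⟨ sym (∑Pairs-+ m _ _) ⟩
  ∑Pairs m (λ l r → 𝟙 (nonEqNodes (node l r) ≡ᵇ suc k) + 𝟙 (flipEq l r) * 𝟙 (nonEqNodes l + nonEqNodes r ≡ᵇ k))
    ≡⟨ ∑Pairs-cong m (λ l r → 𝟙-rootBit+≡ᵇsuc (flipEq l r) (nonEqNodes l) (nonEqNodes r) k) ⟩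
  ∑Pairs m (λ l r → 𝟙 (nonEqNodes l + nonEqNodes r ≡ᵇ k) + 𝟙 (flipEq l r) * 𝟙 (nonEqNodes l + nonEqNodes r ≡ᵇ suc k))
    ≡⟨ ∑Pairs-+ m _ _ ⟩
  pairCount m k + symmetricPairCount m (suc k) ∎
  where open ≡-Reasoning

K-suc-zero : ∀ m → K (suc m) 0 ≡ squareVarsℕ K m 0
K-suc-zero m = begin
  K (suc m) 0               ≡⟨ sym (ℕP.*-identityʳ _) ⟩
  K (suc m) 0 * 2 ^ 0       ≡⟨ sym (orderedTreeCount≡K*2^ℓ (suc m) 0) ⟩
  orderedTreeCount (suc m) 0    ≡⟨ orderedTreeCount-suc-zero m ⟩
  symmetricPairCount m 0        ≡⟨ symmetricPairCount≡ m 0 ⟩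
  squareVarsℕ K m 0 * 2 ^ 0 ≡⟨ ℕP.*-identityʳ _ ⟩
  squareVarsℕ K m 0         ∎
  where open ≡-Reasoning

-- Twice the coefficient of x^(m+1) y^(k+1) in the functional equation.
K-suc-suc : ∀ m k → 2 * K (suc m) (suc k) + squareVarsℕ K m k ≡ (K ⊛ K) m k + 2 * squareVarsℕ K m (suc k)
K-suc-suc m k = ℕP.*-cancelʳ-≡ _ _ (2 ^ k) {{ℕP.m^n≢0 2 k}} (begin
  (2 * K (suc m) (suc k) + squareVarsℕ K m k) * 2 ^ k
    ≡⟨ rearrangeˡ (K (suc m) (suc k)) (squareVarsℕ K m k) (2 ^ k) ⟩
  K (suc m) (suc k) * 2 ^ suc k + squareVarsℕ K m k * 2 ^ k
    ≡⟨ cong₂ _+_ (sym (orderedTreeCount≡K*2^ℓ (suc m) (suc k))) (sym (symmetricPairCount≡ m k)) ⟩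
  orderedTreeCount (suc m) (suc k) + symmetricPairCount m k
    ≡⟨ orderedTreeCount-suc-suc m k ⟩
  pairCount m k + symmetricPairCount m (suc k)
    ≡⟨ cong₂ _+_ (pairCount≡ m k) (symmetricPairCount≡ m (suc k)) ⟩
  (K ⊛ K) m k * 2 ^ k + squareVarsℕ K m (suc k) * 2 ^ suc k
    ≡⟨ sym (rearrangeʳ ((K ⊛ K) m k) (squareVarsℕ K m (suc k)) (2 ^ k)) ⟩
  ((K ⊛ K) m k + 2 * squareVarsℕ K m (suc k)) * 2 ^ k ∎)
  where
  open ≡-Reasoning
  rearrangeˡ : ∀ x y p → (2 * x + y) * p ≡ x * (2 * p) + y * p
  rearrangeˡ = solve-∀
  rearrangeʳ : ∀ x y p → (x + 2 * y) * p ≡ x * p + y * (2 * p)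
  rearrangeʳ = solve-∀

-- Formal power series

infix 4 _≐_
_≐_ : PS → PS → Set
F ≐ G = ∀ n ℓ → F n ℓ ≡ G n ℓ

divX divY : PS → PS
divX F i j = F (suc i) j
divY F i j = F i (suc j)

private variable
  F G H : PS

⊗-congˡ : F ≐ G → F ⊗ H ≐ G ⊗ H
⊗-congˡ {H = H} F≐G n ℓ = ℚ∑.∑-cong
  (λ i → ℚ∑.∑-cong (λ j → cong (ℚ._* H (n ∸ i) (ℓ ∸ j)) (F≐G i j)) (upTo (suc ℓ)))
  (upTo (suc n))

⊕-⊗ : (F ⊕ G) ⊗ H ≐ F ⊗ H ⊕ G ⊗ H
⊕-⊗ {F} {G} {H} n ℓ = trans
  (ℚ∑.∑-cong (λ i → trans (ℚ∑.∑-cong (λ j → ℚP.*-distribʳ-+ (H (n ∸ i) (ℓ ∸ j)) (F i j) (G i j)) (upTo (suc ℓ)))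
                          (ℚ∑.∑-+ {f = λ j → F i j ℚ.* H (n ∸ i) (ℓ ∸ j)} (upTo (suc ℓ))))
             (upTo (suc n)))
  (ℚ∑.∑-+ {f = λ i → ℚ∑.∑ (λ j → F i j ℚ.* H (n ∸ i) (ℓ ∸ j)) (upTo (suc ℓ))} (upTo (suc n)))

·-⊗ : ∀ c → (c · F) ⊗ H ≐ c · (F ⊗ H)
·-⊗ {F} {H} c n ℓ = trans
  (ℚ∑.∑-cong (λ i → trans (ℚ∑.∑-cong (λ j → ℚP.*-assoc c (F i j) (H (n ∸ i) (ℓ ∸ j))) (upTo (suc ℓ)))
                          (ℚ∑.∑-*ˡ {f = λ j → F i j ℚ.* H (n ∸ i) (ℓ ∸ j)} c (upTo (suc ℓ))))
             (upTo (suc n)))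
  (ℚ∑.∑-*ˡ {f = λ i → ℚ∑.∑ (λ j → F i j ℚ.* H (n ∸ i) (ℓ ∸ j)) (upTo (suc ℓ))} c (upTo (suc n)))

const1-⊗ : const 1ℚ ⊗ H ≐ H
const1-⊗ {H} n ℓ = begin
  (const 1ℚ ⊗ H) n ℓ
    ≡⟨ ℚ∑.∑-upTo-head (λ i → ℚ∑.∑ (λ j → const 1ℚ i j ℚ.* H (n ∸ i) (ℓ ∸ j)) (upTo (suc ℓ))) n
                      (λ i → ℚ∑.∑-zero (λ j → ℚP.*-zeroˡ (H (n ∸ suc i) (ℓ ∸ j))) (upTo (suc ℓ))) ⟩
  ℚ∑.∑ (λ j → const 1ℚ 0 j ℚ.* H n (ℓ ∸ j)) (upTo (suc ℓ))
    ≡⟨ ℚ∑.∑-upTo-head (λ j → const 1ℚ 0 j ℚ.* H n (ℓ ∸ j)) ℓ (λ j → ℚP.*-zeroˡ (H n (ℓ ∸ suc j))) ⟩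
  1ℚ ℚ.* H n ℓ
    ≡⟨ ℚP.*-identityˡ (H n ℓ) ⟩
  H n ℓ ∎
  where open ≡-Reasoning

⊗-zero-x : (∀ j → F 0 j ≡ 0ℚ) → ∀ ℓ → (F ⊗ H) 0 ℓ ≡ 0ℚ
⊗-zero-x {F} {H} F₀≡0 ℓ = trans
  (ℚP.+-identityʳ (ℚ∑.∑ (λ j → F 0 j ℚ.* H 0 (ℓ ∸ j)) (upTo (suc ℓ))))
  (ℚ∑.∑-zero (λ j → trans (cong (ℚ._* H 0 (ℓ ∸ j)) (F₀≡0 j)) (ℚP.*-zeroˡ (H 0 (ℓ ∸ j)))) (upTo (suc ℓ)))

⊗-suc-x : (∀ j → F 0 j ≡ 0ℚ) → ∀ n ℓ → (F ⊗ H) (suc n) ℓ ≡ (divX F ⊗ H) n ℓ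
⊗-suc-x {F} {H} F₀≡0 n ℓ = begin
  (F ⊗ H) (suc n) ℓ
    ≡⟨ ℚ∑.∑-upTo-suc (λ i → ℚ∑.∑ (λ j → F i j ℚ.* H (suc n ∸ i) (ℓ ∸ j)) (upTo (suc ℓ))) (suc n) ⟩
  ℚ∑.∑ (λ j → F 0 j ℚ.* H (suc n) (ℓ ∸ j)) (upTo (suc ℓ)) ℚ.+ (divX F ⊗ H) n ℓ
    ≡⟨ cong (ℚ._+ (divX F ⊗ H) n ℓ) (ℚ∑.∑-zero (λ j → trans (cong (ℚ._* H (suc n) (ℓ ∸ j)) (F₀≡0 j))
                                                            (ℚP.*-zeroˡ (H (suc n) (ℓ ∸ j))))
                                               (upTo (suc ℓ))) ⟩
  0ℚ ℚ.+ (divX F ⊗ H) n ℓ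
    ≡⟨ ℚP.+-identityˡ _ ⟩
  (divX F ⊗ H) n ℓ ∎
  where open ≡-Reasoning

⊗-zero-y : (∀ i → F i 0 ≡ 0ℚ) → ∀ n → (F ⊗ H) n 0 ≡ 0ℚ
⊗-zero-y {F} {H} F⁰≡0 n = ℚ∑.∑-zero
  (λ i → trans (ℚP.+-identityʳ (F i 0 ℚ.* H (n ∸ i) 0))
                (trans (cong (ℚ._* H (n ∸ i) 0) (F⁰≡0 i)) (ℚP.*-zeroˡ (H (n ∸ i) 0))))
  (upTo (suc n))

⊗-suc-y : (∀ i → F i 0 ≡ 0ℚ) → ∀ n ℓ → (F ⊗ H) n (suc ℓ) ≡ (divY F ⊗ H) n ℓ
⊗-suc-y {F} {H} F⁰≡0 n ℓ = ℚ∑.∑-cong (λ i → begin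
  ℚ∑.∑ (λ j → F i j ℚ.* H (n ∸ i) (suc ℓ ∸ j)) (upTo (suc (suc ℓ)))
    ≡⟨ ℚ∑.∑-upTo-suc (λ j → F i j ℚ.* H (n ∸ i) (suc ℓ ∸ j)) (suc ℓ) ⟩
  F i 0 ℚ.* H (n ∸ i) (suc ℓ) ℚ.+ ℚ∑.∑ (λ j → F i (suc j) ℚ.* H (n ∸ i) (ℓ ∸ j)) (upTo (suc ℓ))
    ≡⟨ cong (ℚ._+ ℚ∑.∑ (λ j → F i (suc j) ℚ.* H (n ∸ i) (ℓ ∸ j)) (upTo (suc ℓ)))
            (trans (cong (ℚ._* H (n ∸ i) (suc ℓ)) (F⁰≡0 i)) (ℚP.*-zeroˡ (H (n ∸ i) (suc ℓ)))) ⟩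
  0ℚ ℚ.+ ℚ∑.∑ (λ j → F i (suc j) ℚ.* H (n ∸ i) (ℓ ∸ j)) (upTo (suc ℓ))
    ≡⟨ ℚP.+-identityˡ _ ⟩
  ℚ∑.∑ (λ j → F i (suc j) ℚ.* H (n ∸ i) (ℓ ∸ j)) (upTo (suc ℓ)) ∎) (upTo (suc n))
  where open ≡-Reasoning

divX-X : divX X ≐ const 1ℚ
divX-X zero    zero    = refl
divX-X zero    (suc ℓ) = refl
divX-X (suc n) ℓ       = refl

Y-zero-y : ∀ i → Y i 0 ≡ 0ℚ
Y-zero-y zero    = refl
Y-zero-y (suc i) = refl

divY-Y : divY Y ≐ const 1ℚ
divY-Y zero    zero    = refl
divY-Y zero    (suc ℓ) = refl
divY-Y (suc n) zero    = refl
divY-Y (suc n) (suc ℓ) = refl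

X⊗-suc : ∀ n ℓ → (X ⊗ H) (suc n) ℓ ≡ H n ℓ
X⊗-suc {H} n ℓ = trans (⊗-suc-x {X} {H} (λ _ → refl) n ℓ)
                       (trans (⊗-congˡ {divX X} {const 1ℚ} {H} divX-X n ℓ) (const1-⊗ {H} n ℓ))

Y⊗-suc : ∀ n ℓ → (Y ⊗ H) n (suc ℓ) ≡ H n ℓ
Y⊗-suc {H} n ℓ = trans (⊗-suc-y {Y} {H} Y-zero-y n ℓ)
                       (trans (⊗-congˡ {divY Y} {const 1ℚ} {H} divY-Y n ℓ) (const1-⊗ {H} n ℓ))

X⊗⊗-zero : ∀ ℓ → ((X ⊗ F) ⊗ H) 0 ℓ ≡ 0ℚ
X⊗⊗-zero {F} {H} = ⊗-zero-x {X ⊗ F} {H} (⊗-zero-x {X} {F} (λ _ → refl))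

X⊗⊗-suc : ∀ n ℓ → ((X ⊗ F) ⊗ H) (suc n) ℓ ≡ (F ⊗ H) n ℓ
X⊗⊗-suc {F} {H} n ℓ = trans (⊗-suc-x {X ⊗ F} {H} (⊗-zero-x {X} {F} (λ _ → refl)) n ℓ)
                            (⊗-congˡ {divX (X ⊗ F)} {F} {H} X⊗-suc n ℓ)

Φ : PS → PS
Φ F = const 1ℚ ⊕ ½ · (X ⊗ Y ⊗ (F ⊗ F)) ⊕ X ⊗ (const 1ℚ ⊖ ½ · Y) ⊗ squareVars F

1-½Y≐1+[-½]Y : const 1ℚ ⊖ ½ · Y ≐ const 1ℚ ⊕ (ℚ.- ½) · Y
1-½Y≐1+[-½]Y n ℓ = cong (const 1ℚ n ℓ ℚ.+_) (ℚP.neg-distribˡ-* ½ (Y n ℓ))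

Φ-zero : ∀ F ℓ → Φ F 0 ℓ ≡ const 1ℚ 0 ℓ
Φ-zero F ℓ = trans
  (cong₂ (λ p q → const 1ℚ 0 ℓ ℚ.+ ½ ℚ.* p ℚ.+ q) (X⊗⊗-zero {Y} {F ⊗ F} ℓ)
                                                 (X⊗⊗-zero {const 1ℚ ⊖ ½ · Y} {squareVars F} ℓ))
  (trans (ℚP.+-identityʳ _) (ℚP.+-identityʳ _))

Φ-suc : ∀ F m ℓ → Φ F (suc m) ℓ ≡
  ½ ℚ.* (Y ⊗ (F ⊗ F)) m ℓ ℚ.+ (squareVars F m ℓ ℚ.+ (ℚ.- ½) ℚ.* (Y ⊗ squareVars F) m ℓ)
Φ-suc F m ℓ = begin
  Φ F (suc m) ℓ
    ≡⟨ cong₂ (λ p q → 0ℚ ℚ.+ ½ ℚ.* p ℚ.+ q) (X⊗⊗-suc {Y} {F ⊗ F} m ℓ)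
                                            (X⊗⊗-suc {const 1ℚ ⊖ ½ · Y} {squareVars F} m ℓ) ⟩
  0ℚ ℚ.+ ½ ℚ.* (Y ⊗ (F ⊗ F)) m ℓ ℚ.+ ((const 1ℚ ⊖ ½ · Y) ⊗ squareVars F) m ℓ
    ≡⟨ cong₂ ℚ._+_ (ℚP.+-identityˡ (½ ℚ.* (Y ⊗ (F ⊗ F)) m ℓ)) (begin
         ((const 1ℚ ⊖ ½ · Y) ⊗ squareVars F) m ℓ
           ≡⟨ ⊗-congˡ {H = squareVars F} 1-½Y≐1+[-½]Y m ℓ ⟩
         ((const 1ℚ ⊕ (ℚ.- ½) · Y) ⊗ squareVars F) m ℓ
           ≡⟨ ⊕-⊗ {const 1ℚ} {(ℚ.- ½) · Y} {squareVars F} m ℓ ⟩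
         (const 1ℚ ⊗ squareVars F) m ℓ ℚ.+ (((ℚ.- ½) · Y) ⊗ squareVars F) m ℓ
           ≡⟨ cong₂ ℚ._+_ (const1-⊗ {squareVars F} m ℓ) (·-⊗ {Y} {squareVars F} (ℚ.- ½) m ℓ) ⟩
         squareVars F m ℓ ℚ.+ (ℚ.- ½) ℚ.* (Y ⊗ squareVars F) m ℓ ∎) ⟩
  ½ ℚ.* (Y ⊗ (F ⊗ F)) m ℓ ℚ.+ (squareVars F m ℓ ℚ.+ (ℚ.- ½) ℚ.* (Y ⊗ squareVars F) m ℓ) ∎
  where open ≡-Reasoning

Φ-suc-zero : ∀ F m → Φ F (suc m) 0 ≡ squareVars F m 0
Φ-suc-zero F m = trans (Φ-suc F m 0) (trans
  (cong₂ (λ p q → ½ ℚ.* p ℚ.+ (squareVars F m 0 ℚ.+ (ℚ.- ½) ℚ.* q))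
         (⊗-zero-y {Y} {F ⊗ F} Y-zero-y m) (⊗-zero-y {Y} {squareVars F} Y-zero-y m))
  (trans (ℚP.+-identityˡ _) (ℚP.+-identityʳ _)))

Φ-suc-suc : ∀ F m k → Φ F (suc m) (suc k) ≡
  ½ ℚ.* (F ⊗ F) m k ℚ.+ (squareVars F m (suc k) ℚ.+ (ℚ.- ½) ℚ.* squareVars F m k)
Φ-suc-suc F m k = trans (Φ-suc F m (suc k))
  (cong₂ (λ p q → ½ ℚ.* p ℚ.+ (squareVars F m (suc k) ℚ.+ (ℚ.- ½) ℚ.* q))
         (Y⊗-suc {F ⊗ F} m k) (Y⊗-suc {squareVars F} m k))

-- fromℕℚ n is definitionally fromℚᵘ (mkℚᵘ (+ n) 0), so its arithmetic is checked on
-- unnormalised rationals.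
toℚᵘ-fromℕℚ : ∀ n → toℚᵘ (fromℕℚ n) ℚᵘ.≃ ℚᵘ.mkℚᵘ (ℤ.+ n) 0
toℚᵘ-fromℕℚ n = ℚP.toℚᵘ-fromℚᵘ (ℚᵘ.mkℚᵘ (ℤ.+ n) 0)

fromℕℚ-+ : ∀ a b → fromℕℚ (a + b) ≡ fromℕℚ a ℚ.+ fromℕℚ b
fromℕℚ-+ a b = ℚP.toℚᵘ-injective (begin
  toℚᵘ (fromℕℚ (a + b))                        ≈⟨ toℚᵘ-fromℕℚ (a + b) ⟩
  ℚᵘ.mkℚᵘ (ℤ.+ (a + b)) 0                         ≡⟨ cong (λ z → ℚᵘ.mkℚᵘ z 0) (ℤP.pos-+ a b) ⟩
  ℚᵘ.mkℚᵘ (ℤ.+ a ℤ.+ ℤ.+ b) 0                       ≡⟨ sym (cong₂ (λ x y → ℚᵘ.mkℚᵘ (x ℤ.+ y) 0)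
                                                                  (ℤP.*-identityʳ (ℤ.+ a)) (ℤP.*-identityʳ (ℤ.+ b))) ⟩
  ℚᵘ.mkℚᵘ (ℤ.+ a) 0 ℚᵘ.+ ℚᵘ.mkℚᵘ (ℤ.+ b) 0          ≈⟨ ℚᵘP.+-cong (toℚᵘ-fromℕℚ a) (toℚᵘ-fromℕℚ b) ⟨
  toℚᵘ (fromℕℚ a) ℚᵘ.+ toℚᵘ (fromℕℚ b)          ≈⟨ ℚP.toℚᵘ-homo-+ (fromℕℚ a) (fromℕℚ b) ⟨
  toℚᵘ (fromℕℚ a ℚ.+ fromℕℚ b)                  ∎)
  where open ℚᵘP.≃-Reasoning

fromℕℚ-* : ∀ a b → fromℕℚ (a * b) ≡ fromℕℚ a ℚ.* fromℕℚ b
fromℕℚ-* a b = ℚP.toℚᵘ-injective (begin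
  toℚᵘ (fromℕℚ (a * b))                        ≈⟨ toℚᵘ-fromℕℚ (a * b) ⟩
  ℚᵘ.mkℚᵘ (ℤ.+ (a * b)) 0                         ≡⟨ cong (λ z → ℚᵘ.mkℚᵘ z 0) (ℤP.pos-* a b) ⟩
  ℚᵘ.mkℚᵘ (ℤ.+ a) 0 ℚᵘ.* ℚᵘ.mkℚᵘ (ℤ.+ b) 0          ≈⟨ ℚᵘP.*-cong (toℚᵘ-fromℕℚ a) (toℚᵘ-fromℕℚ b) ⟨
  toℚᵘ (fromℕℚ a) ℚᵘ.* toℚᵘ (fromℕℚ b)          ≈⟨ ℚP.toℚᵘ-homo-* (fromℕℚ a) (fromℕℚ b) ⟨
  toℚᵘ (fromℕℚ a ℚ.* fromℕℚ b)                  ∎)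
  where open ℚᵘP.≃-Reasoning

fromℕℚ-∑ : ∀ {A : Set} (f : A → ℕ) xs → fromℕℚ (∑ f xs) ≡ ℚ∑.∑ (fromℕℚ ∘ f) xs
fromℕℚ-∑ f []       = refl
fromℕℚ-∑ f (x ∷ xs) = trans (fromℕℚ-+ (f x) (∑ f xs)) (cong (fromℕℚ (f x) ℚ.+_) (fromℕℚ-∑ f xs))

fromℕPS : (ℕ → ℕ → ℕ) → PS
fromℕPS f n ℓ = fromℕℚ (f n ℓ)

fromℕPS-⊛ : ∀ f g → fromℕPS (f ⊛ g) ≐ fromℕPS f ⊗ fromℕPS g
fromℕPS-⊛ f g n ℓ = trans (fromℕℚ-∑ (λ i → ∑ (λ j → f i j * g (n ∸ i) (ℓ ∸ j)) (upTo (suc ℓ))) (upTo (suc n)))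
  (ℚ∑.∑-cong (λ i → trans (fromℕℚ-∑ (λ j → f i j * g (n ∸ i) (ℓ ∸ j)) (upTo (suc ℓ)))
                          (ℚ∑.∑-cong (λ j → fromℕℚ-* (f i j) (g (n ∸ i) (ℓ ∸ j))) (upTo (suc ℓ))))
             (upTo (suc n)))

fromℕPS-squareVarsℕ : ∀ f → fromℕPS (squareVarsℕ f) ≐ squareVars (fromℕPS f)
fromℕPS-squareVarsℕ f n ℓ with isEven n ∧ isEven ℓ
... | true  = refl
... | false = refl

L-zero : ∀ ℓ → L 0 ℓ ≡ const 1ℚ 0 ℓ
L-zero zero    = refl
L-zero (suc ℓ) = refl

L-suc-zero : ∀ m → L (suc m) 0 ≡ squareVars L m 0
L-suc-zero m = trans (cong fromℕℚ (K-suc-zero m)) (fromℕPS-squareVarsℕ K m 0)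

L-suc-suc : ∀ m k →
  fromℕℚ 2 ℚ.* L (suc m) (suc k) ℚ.+ squareVars L m k ≡ (L ⊗ L) m k ℚ.+ fromℕℚ 2 ℚ.* squareVars L m (suc k)
L-suc-suc m k = begin
  fromℕℚ 2 ℚ.* L (suc m) (suc k) ℚ.+ squareVars L m k
    ≡⟨ cong₂ ℚ._+_ (sym (fromℕℚ-* 2 (K (suc m) (suc k)))) (sym (fromℕPS-squareVarsℕ K m k)) ⟩
  fromℕℚ (2 * K (suc m) (suc k)) ℚ.+ fromℕℚ (squareVarsℕ K m k)
    ≡⟨ sym (fromℕℚ-+ (2 * K (suc m) (suc k)) (squareVarsℕ K m k)) ⟩
  fromℕℚ (2 * K (suc m) (suc k) + squareVarsℕ K m k)
    ≡⟨ cong fromℕℚ (K-suc-suc m k) ⟩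
  fromℕℚ ((K ⊛ K) m k + 2 * squareVarsℕ K m (suc k))
    ≡⟨ fromℕℚ-+ ((K ⊛ K) m k) (2 * squareVarsℕ K m (suc k)) ⟩
  fromℕℚ ((K ⊛ K) m k) ℚ.+ fromℕℚ (2 * squareVarsℕ K m (suc k))
    ≡⟨ cong₂ ℚ._+_ (fromℕPS-⊛ K K m k)
                   (trans (fromℕℚ-* 2 (squareVarsℕ K m (suc k)))
                          (cong (fromℕℚ 2 ℚ.*_) (fromℕPS-squareVarsℕ K m (suc k)))) ⟩
  (L ⊗ L) m k ℚ.+ fromℕℚ 2 ℚ.* squareVars L m (suc k) ∎
  where open ≡-Reasoning

2κ+s₀≡c+2s₁⇒κ≡½c+s₁-½s₀ : ∀ {κ c s₀ s₁} → fromℕℚ 2 ℚ.* κ ℚ.+ s₀ ≡ c ℚ.+ fromℕℚ 2 ℚ.* s₁ →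
        κ ≡ ½ ℚ.* c ℚ.+ (s₁ ℚ.+ (ℚ.- ½) ℚ.* s₀)
2κ+s₀≡c+2s₁⇒κ≡½c+s₁-½s₀ {κ} {c} {s₀} {s₁} eq = begin
  κ                                                           ≡⟨ κ≡½[2κ+s₀]-½s₀ κ s₀ ⟩
  ½ ℚ.* (fromℕℚ 2 ℚ.* κ ℚ.+ s₀) ℚ.+ (ℚ.- ½) ℚ.* s₀           ≡⟨ cong (λ x → ½ ℚ.* x ℚ.+ (ℚ.- ½) ℚ.* s₀) eq ⟩
  ½ ℚ.* (c ℚ.+ fromℕℚ 2 ℚ.* s₁) ℚ.+ (ℚ.- ½) ℚ.* s₀           ≡⟨ distrib-½ c s₀ s₁ ⟩
  ½ ℚ.* c ℚ.+ (s₁ ℚ.+ (ℚ.- ½) ℚ.* s₀)                         ∎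
  where
  open ≡-Reasoning
  open +-*-Solver
  κ≡½[2κ+s₀]-½s₀ : ∀ κ s₀ → κ ≡ ½ ℚ.* (fromℕℚ 2 ℚ.* κ ℚ.+ s₀) ℚ.+ (ℚ.- ½) ℚ.* s₀
  κ≡½[2κ+s₀]-½s₀ = solve 2 (λ κ s₀ → κ := con ½ :* (con (fromℕℚ 2) :* κ :+ s₀) :+ con (ℚ.- ½) :* s₀) refl
  distrib-½ : ∀ c s₀ s₁ →
    ½ ℚ.* (c ℚ.+ fromℕℚ 2 ℚ.* s₁) ℚ.+ (ℚ.- ½) ℚ.* s₀ ≡ ½ ℚ.* c ℚ.+ (s₁ ℚ.+ (ℚ.- ½) ℚ.* s₀)
  distrib-½ = solve 3 (λ c s₀ s₁ → con ½ :* (c :+ con (fromℕℚ 2) :* s₁) :+ con (ℚ.- ½) :* s₀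
                                := con ½ :* c :+ (s₁ :+ con (ℚ.- ½) :* s₀)) refl

mainTheorem1 : ∀ (n ℓ : ℕ) →
    L n ℓ ≡ (const 1ℚ ⊕ ½ · (X ⊗ Y ⊗ (L ⊗ L)) ⊕ X ⊗ (const 1ℚ ⊖ ½ · Y) ⊗ squareVars L) n ℓ
mainTheorem1 zero    ℓ       = trans (L-zero ℓ) (sym (Φ-zero L ℓ))
mainTheorem1 (suc m) zero    = trans (L-suc-zero m) (sym (Φ-suc-zero L m))
mainTheorem1 (suc m) (suc k) =
  trans (2κ+s₀≡c+2s₁⇒κ≡½c+s₁-½s₀ {c = (L ⊗ L) m k} {s₁ = squareVars L m (suc k)} (L-suc-suc m k))
        (sym (Φ-suc-suc L m k))
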